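{- Let $r\ge 1$ and $n\ge 0$ be integers. If $r$ is odd, then $$ \sum_{\substack{k_1+\cdots+k_r=n\\ k_1,\dots,k_r\ge 1}}\binom{n}{k_1,\dots,k_r}F_{k_1}\cdots F_{k_r} =\frac{1}{(\sqrt{5})^{r-1}}\sum_{k=0}^n\binom{n}{k}\sum_{j=0}^{\frac{r-1}{2}}(-1)^j\binom{r}{j}j^{n-k}(r-2 j)^k F_k $$ and $$ \sum_{\substack{k_1+\cdots+k_r=n\\ k_1,\dots,k_r\ge 0}}\binom{n}{k_1,\dots,k_r}L_{k_1}\cdots L_{k_r} =\sum_{k=0}^n\binom{n}{k}\sum_{j=0}^{\frac{r-1}{2}}\binom{r}{j}j^{n-k}(r-2 j)^k L_k\,. $$ If $r$ is even, then $$ \sum_{\substack{k_1+\cdots+k_r=n\\ k_1,\dots,k_r\ge 1}}\binom{n}{k_1,\dots,k_r}F_{k_1}\cdots F_{k_r} =\frac{1}{(\sqrt{5})^{r}}\left(\sum_{k=0}^n\binom{n}{k}\sum_{j=0}^{\frac{r}{2}-1}(-1)^j\binom{r}{j}j^{n-k}(r-2 j)^k L_k +(-1)^{\frac{r}{2}}\binom{r}{\frac{r}{2}}\left(\frac{r}{2}\right)^n\right) $$ and $$ \sum_{\substack{k_1+\cdots+k_r=n\\ k_1,\dots,k_r\ge 0}}\binom{n}{k_1,\dots,k_r}L_{k_1}\cdots L_{k_r} =\sum_{k=0}^n\binom{n}{k}\sum_{j=0}^{\frac{r}{2}-1}\binom{r}{j}j^{n-k}(r-2 j)^k L_k +\binom{r}{\frac{r}{2}}\left(\frac{r}{2}\right)^n\,.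 $$
   Context: $F_n$ are the Fibonacci numbers ($F_0=0$, $F_1=1$, $F_n=F_{n-1}+F_{n-2}$) and $L_n$ the Lucas numbers ($L_0=2$, $L_1=1$, $L_n=L_{n-1}+L_{n-2}$). $\binom{n}{k_1,\dots,k_r}=\frac{n!}{k_1!\cdots k_r!}$ is the multinomial coefficient; the sums on the left are over ordered $r$-tuples with the indicated bounds summing to $n$. The convention $0^0=1$ is used. -}

module Defs where

open import Data.Nat as ℕ using (ℕ; zero; suc; _≤_; _∸_; _!; NonZero)
open import Data.Nat.Properties using (_≟_; _≤?_; m*n≢0; _!≢0)
open import Data.Nat.Combinatorics using (_C_)
open import Data.Nat.DivMod using (_/_)
open import Data.Integer as ℤ using (ℤ; +_)
open import Data.List as List using (List; []; _∷_; upTo; concatMap; filter)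
open import Data.Vec as Vec using (Vec; []; _∷_)
open import Data.Vec.Relation.Unary.All as All using (All; all?)
open import Data.Product using (_×_)
open import Relation.Nullary using (_×-dec_)
open import Relation.Binary.PropositionalEquality using (_≡_)

F : ℕ → ℕ
F zero = 0
F (suc zero) = 1
F (suc (suc n)) = F (suc n) ℕ.+ F n

L : ℕ → ℕ
L zero = 2
L (suc zero) = 1
L (suc (suc n)) = L (suc n) ℕ.+ L n

prodFact : ∀ {r} → Vec ℕ r → ℕ
prodFact [] = 1
prodFact (k ∷ ks) = k ! ℕ.* prodFact ks

prodFact≢0 : ∀ {r} (v : Vec ℕ r) → NonZero (prodFact v)
prodFact≢0 [] = _
prodFact≢0 (k ∷ ks) = m*n≢0 (k !) (prodFact ks) {{k !≢0}} {{prodFact≢0 ks}}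

multinomial : ∀ {r} → ℕ → Vec ℕ r → ℕ
multinomial n v = (n ! / prodFact v) {{prodFact≢0 v}}

allVecs : (r m : ℕ) → List (Vec ℕ r)
allVecs zero m = [] ∷ []
allVecs (suc r) m = concatMap (λ k → List.map (k ∷_) (allVecs r m)) (upTo m)

tuples : (r n b : ℕ) → List (Vec ℕ r)
tuples r n b =
  filter (λ v → (Vec.sum v ≟ n) ×-dec all? (b ≤?_) v) (allVecs r (suc n))

sumℤ : List ℤ → ℤ
sumℤ = List.foldr ℤ._+_ (+ 0)

prodG : ∀ {r} → (ℕ → ℕ) → Vec ℕ r → ℕ
prodG G [] = 1
prodG G (k ∷ ks) = G k ℕ.* prodG G ks

multiSum : (G : ℕ → ℕ) (r n b : ℕ) → ℤ
multiSum G r n b =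
  sumℤ (List.map (λ v → + (multinomial n v ℕ.* prodG G v))
                     (tuples r n b))

sumTo : ℕ → (ℕ → ℤ) → ℤ
sumTo m f = sumℤ (List.map f (upTo (suc m)))

sgn : ℕ → ℤ
sgn j = (ℤ.- (+ 1)) ℤ.^ j

-- Σ_{k=0}^n C(n,k) Σ_{j=0}^{J} s(j) C(r,j) j^{n-k} (r-2j)^k G_k
-- (s is the sign factor: sgn for (-1)^j, or const 1)
innerSum : (s : ℕ → ℤ) (G : ℕ → ℕ) (r n J : ℕ) → ℤ
innerSum s G r n J =
  sumTo n λ k → (+ (n C k)) ℤ.*
    sumTo J λ j → s j ℤ.* (+ (r C j)) ℤ.* ((+ j) ℤ.^ (n ∸ k))
                   ℤ.* ((+ (r ∸ 2 ℕ.* j)) ℤ.^ k) ℤ.* (+ G k)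

module Submission where

-- We compute in the ring ℤ[φ] = ℤ[x]/(x² − x − 1), in which φ and ψ = 1 − φ are the roots of
-- x² = x + 1 and √5 = φ − ψ, so that Binet's formulas read φᵏ − ψᵏ = √5·F_k, φᵏ + ψᵏ = L_k.
-- A multinomial sum Σ (n; k₁,…,kᵣ) G_{k₁}⋯G_{kᵣ} is n! times the n-th coefficient of the r-th
-- power of the exponential generating function of G, i.e. an r-fold binomial convolution power
-- (module MultinomialSum). For G = √5·F and G = L that generating function is e^{φx} ∓ e^{ψx},
-- whose r-th power the binomial theorem expands as Σⱼ C(r,j) (∓1)ʲ e^{(jψ + (r−j)φ)x}
-- (twoExp-power). Pairing the terms j and r − j and using φ + ψ = 1 turns this into a sum of
-- C(r,j) (∓1)ʲ [e^{(mφ + j)x} ± e^{(mψ + j)x}] with m = r − 2j (pair-terms); expanding these once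
-- more, Binet's formulas produce the double sum innerSum (pairedSum≡innerSum). For even r the
-- middle term j = r/2 stays unpaired.

open import Defs
open import Data.Nat using (ℕ; _≤_; _∸_; _%_; _/_)
open import Data.Nat.Combinatorics using (_C_)
open import Data.Integer using (ℤ; +_; _+_; _*_; _^_)
open import Data.Product using (_×_)
open import Relation.Binary.PropositionalEquality using (_≡_)

open import Level using (0ℓ)
open import Data.Nat as ℕ using (zero; suc; _!; _≤?_)
import Data.Nat.Properties as ℕ
open import Data.Nat.Properties using (_≟_)
open import Data.Nat.DivMod using (m*n/n≡m; m/n*n≡m; m*n%n≡0; [m+kn]%n≡m%n)
open import Data.Nat.Divisibility using (_∣_; divides; ∣-trans; *-monoʳ-∣)
open import Data.Nat.Combinatorics using (k![n∸k]!∣n!; nCk+nC[k+1]≡[n+1]C[k+1]; nCk≡nC[n∸k])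
open import Data.Nat.Combinatorics.Specification using (nCk≡n!/k![n-k]!; k>n⇒nCk≡0)
import Data.Nat.Tactic.RingSolver as ℕ-Solver
open import Data.Integer as ℤ using (-[1+_])
import Data.Integer.Properties as ℤ
import Data.Integer.Tactic.RingSolver as ℤ-Solver
open import Data.Fin using (Fin; toℕ)
open import Data.List as List using (List; []; _∷_; upTo; applyUpTo; concatMap; filter; _++_)
open import Data.Vec as Vec using (Vec)
open import Data.Vec.Relation.Unary.All as All using (All; all?)
open import Data.Maybe using (Maybe; just; nothing)
open import Data.Product using (_,_; proj₁; proj₂)
open import Data.Empty using (⊥-elim)
open import Relation.Nullary using (Dec; yes; no; _×-dec_; contradiction)
open import Relation.Binary.PropositionalEquality
  using (refl; sym; trans; cong; cong₂; subst; isEquivalence; module ≡-Reasoning)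
open import Algebra.Bundles using (CommutativeRing)
open import Algebra.Structures using (IsCommutativeRing)
import Tactic.RingSolver.Core.AlmostCommutativeRing as ACR

-- ⟨ a , b ⟩ represents a + bφ; multiplication uses φ² = φ + 1.
infix 5 ⟨_,_⟩
data ℤ[φ] : Set where
  ⟨_,_⟩ : ℤ → ℤ → ℤ[φ]

infixl 6 _+ᴿ_
infixl 7 _*ᴿ_
infix 8 -ᴿ_

_+ᴿ_ : ℤ[φ] → ℤ[φ] → ℤ[φ]
⟨ a , b ⟩ +ᴿ ⟨ c , d ⟩ = ⟨ a + c , b + d ⟩

_*ᴿ_ : ℤ[φ] → ℤ[φ] → ℤ[φ]
⟨ a , b ⟩ *ᴿ ⟨ c , d ⟩ = ⟨ a * c + b * d , a * d + b * c + b * d ⟩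

-ᴿ_ : ℤ[φ] → ℤ[φ]
-ᴿ ⟨ a , b ⟩ = ⟨ ℤ.- a , ℤ.- b ⟩

0ᴿ 1ᴿ : ℤ[φ]
0ᴿ = ⟨ + 0 , + 0 ⟩
1ᴿ = ⟨ + 1 , + 0 ⟩

ℤ[φ]-isCommutativeRing : IsCommutativeRing _≡_ _+ᴿ_ _*ᴿ_ -ᴿ_ 0ᴿ 1ᴿ
ℤ[φ]-isCommutativeRing = record
  { isRing = record
    { +-isAbelianGroup = record
      { isGroup = record
        { isMonoid = record
          { isSemigroup = record
            { isMagma = record { isEquivalence = isEquivalence ; ∙-cong = cong₂ _+ᴿ_ }
            ; assoc = +-assoc }
          ; identity = +-identityˡ , +-identityʳ }
        ; inverse = +-inverseˡ , +-inverseʳ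
        ; ⁻¹-cong = cong -ᴿ_ }
      ; comm = +-comm }
    ; *-cong = cong₂ _*ᴿ_
    ; *-assoc = *-assoc
    ; *-identity = *-identityˡ , *-identityʳ
    ; distrib = *-distribˡ , *-distribʳ }
  ; *-comm = *-comm }
  where
  open ℤ-Solver using (solve)
  +-assoc : ∀ x y z → (x +ᴿ y) +ᴿ z ≡ x +ᴿ (y +ᴿ z)
  +-assoc ⟨ a , b ⟩ ⟨ c , d ⟩ ⟨ e , f ⟩ = cong₂ ⟨_,_⟩ (ℤ.+-assoc a c e) (ℤ.+-assoc b d f)
  +-comm : ∀ x y → x +ᴿ y ≡ y +ᴿ x
  +-comm ⟨ a , b ⟩ ⟨ c , d ⟩ = cong₂ ⟨_,_⟩ (ℤ.+-comm a c) (ℤ.+-comm b d)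
  +-identityˡ : ∀ x → 0ᴿ +ᴿ x ≡ x
  +-identityˡ ⟨ a , b ⟩ = cong₂ ⟨_,_⟩ (ℤ.+-identityˡ a) (ℤ.+-identityˡ b)
  +-identityʳ : ∀ x → x +ᴿ 0ᴿ ≡ x
  +-identityʳ ⟨ a , b ⟩ = cong₂ ⟨_,_⟩ (ℤ.+-identityʳ a) (ℤ.+-identityʳ b)
  +-inverseˡ : ∀ x → -ᴿ x +ᴿ x ≡ 0ᴿ
  +-inverseˡ ⟨ a , b ⟩ = cong₂ ⟨_,_⟩ (ℤ.+-inverseˡ a) (ℤ.+-inverseˡ b)
  +-inverseʳ : ∀ x → x +ᴿ -ᴿ x ≡ 0ᴿ
  +-inverseʳ ⟨ a , b ⟩ = cong₂ ⟨_,_⟩ (ℤ.+-inverseʳ a) (ℤ.+-inverseʳ b)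
  *-assoc : ∀ x y z → (x *ᴿ y) *ᴿ z ≡ x *ᴿ (y *ᴿ z)
  *-assoc ⟨ a , b ⟩ ⟨ c , d ⟩ ⟨ e , f ⟩ =
    cong₂ ⟨_,_⟩ (solve (a ∷ b ∷ c ∷ d ∷ e ∷ f ∷ [])) (solve (a ∷ b ∷ c ∷ d ∷ e ∷ f ∷ []))
  *-comm : ∀ x y → x *ᴿ y ≡ y *ᴿ x
  *-comm ⟨ a , b ⟩ ⟨ c , d ⟩ = cong₂ ⟨_,_⟩ (solve (a ∷ b ∷ c ∷ d ∷ [])) (solve (a ∷ b ∷ c ∷ d ∷ []))
  *-identityˡ : ∀ x → 1ᴿ *ᴿ x ≡ x
  *-identityˡ ⟨ a , b ⟩ = cong₂ ⟨_,_⟩ (solve (a ∷ b ∷ [])) (solve (a ∷ b ∷ []))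
  *-identityʳ : ∀ x → x *ᴿ 1ᴿ ≡ x
  *-identityʳ x = trans (*-comm x 1ᴿ) (*-identityˡ x)
  *-distribˡ : ∀ x y z → x *ᴿ (y +ᴿ z) ≡ x *ᴿ y +ᴿ x *ᴿ z
  *-distribˡ ⟨ a , b ⟩ ⟨ c , d ⟩ ⟨ e , f ⟩ =
    cong₂ ⟨_,_⟩ (solve (a ∷ b ∷ c ∷ d ∷ e ∷ f ∷ [])) (solve (a ∷ b ∷ c ∷ d ∷ e ∷ f ∷ []))
  *-distribʳ : ∀ x y z → (y +ᴿ z) *ᴿ x ≡ y *ᴿ x +ᴿ z *ᴿ x
  *-distribʳ x y z = trans (*-comm (y +ᴿ z) x)
    (trans (*-distribˡ x y z) (cong₂ _+ᴿ_ (*-comm x y) (*-comm x z)))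

ℤ[φ]-commutativeRing : CommutativeRing 0ℓ 0ℓ
ℤ[φ]-commutativeRing = record { isCommutativeRing = ℤ[φ]-isCommutativeRing }

ℤ[φ]-ring : ACR.AlmostCommutativeRing 0ℓ 0ℓ
ℤ[φ]-ring = ACR.fromCommutativeRing ℤ[φ]-commutativeRing isZero
  where
  isZero : ∀ x → Maybe (0ᴿ ≡ x)
  isZero ⟨ + 0 , + 0 ⟩ = just refl
  isZero _ = nothing

open import Tactic.RingSolver using (solve)
open CommutativeRing ℤ[φ]-commutativeRing
  using ( semiring; commutativeSemiring; +-assoc; +-comm; +-identityˡ; +-identityʳ
        ; *-assoc; *-identityˡ; *-identityʳ; zeroˡ; zeroʳ; distribˡ; distribʳ )
open import Algebra.Properties.CommutativeSemiring.Exp commutativeSemiring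
  using (^-homo-*; ^-distrib-*) renaming (_^_ to _^ᴿ_)
open import Algebra.Properties.Semiring.Sum semiring
  using (sum; sum-cong-≗; ∑-distrib-+; ∑-comm; *-distribˡ-sum)
open import Algebra.Properties.Semiring.Mult semiring using () renaming (_×_ to _×ᴿ_)
import Algebra.Properties.CommutativeSemiring.Binomial commutativeSemiring as Binomial
open ≡-Reasoning

ι : ℤ → ℤ[φ]
ι a = ⟨ a , + 0 ⟩

ιn : ℕ → ℤ[φ]
ιn n = ι (+ n)

ι-* : ∀ a b → ι (a * b) ≡ ι a *ᴿ ι b
ι-* a b = cong₂ ⟨_,_⟩ (ℤ-Solver.solve (a ∷ b ∷ [])) (ℤ-Solver.solve (a ∷ b ∷ []))

ιn-* : ∀ m n → ιn (m ℕ.* n) ≡ ιn m *ᴿ ιn n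
ιn-* m n = trans (cong ι (ℤ.pos-* m n)) (ι-* (+ m) (+ n))

ι-^ : ∀ a n → ι (a ^ n) ≡ ι a ^ᴿ n
ι-^ a zero = refl
ι-^ a (suc n) = trans (ι-* a (a ^ n)) (cong (ι a *ᴿ_) (ι-^ a n))

1^n≡1 : ∀ n → 1ᴿ ^ᴿ n ≡ 1ᴿ
1^n≡1 zero = refl
1^n≡1 (suc n) = trans (*-identityˡ (1ᴿ ^ᴿ n)) (1^n≡1 n)

×≡ιn* : ∀ n x → n ×ᴿ x ≡ ιn n *ᴿ x
×≡ιn* zero x = solve (x ∷ []) ℤ[φ]-ring
×≡ιn* (suc n) x = begin
  x +ᴿ n ×ᴿ x      ≡⟨ cong (x +ᴿ_) (×≡ιn* n x) ⟩
  x +ᴿ ιn n *ᴿ x   ≡⟨ distrib (ιn n) ⟩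
  (1ᴿ +ᴿ ιn n) *ᴿ x ∎
  where
  distrib : ∀ y → x +ᴿ y *ᴿ x ≡ (1ᴿ +ᴿ y) *ᴿ x
  distrib y = solve (x ∷ y ∷ []) ℤ[φ]-ring

-- Finite sums Σ_{k<n} f(k) and Σ_{k≤n} f(k) of ℕ-indexed sequences, as library sums over Fin n,
-- so that the library's rearrangement lemmas apply.
Σ< : ℕ → (ℕ → ℤ[φ]) → ℤ[φ]
Σ< n f = sum (λ (i : Fin n) → f (toℕ i))

Σ≤ : ℕ → (ℕ → ℤ[φ]) → ℤ[φ]
Σ≤ n f = Σ< (suc n) f

infix 5 Σ< Σ≤
syntax Σ< n (λ k → x) = Σ[ k < n ] x
syntax Σ≤ n (λ k → x) = Σ[ k ≤ n ] x

Σ-cong : ∀ n {f g : ℕ → ℤ[φ]} → (∀ k → f k ≡ g k) → Σ< n f ≡ Σ< n g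
Σ-cong n f≗g = sum-cong-≗ {n} (λ i → f≗g (toℕ i))

Σ-cong-< : ∀ n {f g : ℕ → ℤ[φ]} → (∀ k → k ℕ.< n → f k ≡ g k) → Σ< n f ≡ Σ< n g
Σ-cong-< zero f≗g = refl
Σ-cong-< (suc n) f≗g =
  cong₂ _+ᴿ_ (f≗g 0 (ℕ.s≤s ℕ.z≤n)) (Σ-cong-< n (λ k k<n → f≗g (suc k) (ℕ.s≤s k<n)))

Σ-distrib-+ : ∀ n (f g : ℕ → ℤ[φ]) → Σ[ k < n ] (f k +ᴿ g k) ≡ Σ< n f +ᴿ Σ< n g
Σ-distrib-+ n f g = ∑-distrib-+ {n} (λ i → f (toℕ i)) (λ i → g (toℕ i))

Σ-distribˡ-* : ∀ n c (f : ℕ → ℤ[φ]) → c *ᴿ Σ< n f ≡ Σ[ k < n ] (c *ᴿ f k)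
Σ-distribˡ-* n c f = *-distribˡ-sum {n} c (λ i → f (toℕ i))

Σ-comm : ∀ m n (f : ℕ → ℕ → ℤ[φ]) → Σ[ i < m ] Σ[ j < n ] f i j ≡ Σ[ j < n ] Σ[ i < m ] f i j
Σ-comm m n f = ∑-comm {m} {n} (λ i j → f (toℕ i) (toℕ j))

Σ-split : ∀ m n (f : ℕ → ℤ[φ]) → Σ< (m ℕ.+ n) f ≡ Σ< m f +ᴿ (Σ[ k < n ] f (m ℕ.+ k))
Σ-split zero n f = sym (+-identityˡ (Σ< n f))
Σ-split (suc m) n f =
  trans (cong (f 0 +ᴿ_) (Σ-split m n (λ k → f (suc k)))) (sym (+-assoc (f 0) _ _))

Σ-last : ∀ n (f : ℕ → ℤ[φ]) → Σ≤ n f ≡ Σ< n f +ᴿ f n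
Σ-last n f = begin
  Σ< (suc n) f                   ≡⟨ cong (λ m → Σ< m f) (ℕ.+-comm 1 n) ⟩
  Σ< (n ℕ.+ 1) f                 ≡⟨ Σ-split n 1 f ⟩
  Σ< n f +ᴿ (f (n ℕ.+ 0) +ᴿ 0ᴿ)  ≡⟨ cong (Σ< n f +ᴿ_) (trans (+-identityʳ _) (cong f (ℕ.+-identityʳ n))) ⟩
  Σ< n f +ᴿ f n                  ∎

Σ-reverse : ∀ n (f : ℕ → ℤ[φ]) → Σ≤ n f ≡ Σ[ k ≤ n ] f (n ∸ k)
Σ-reverse zero f = refl
Σ-reverse (suc n) f = begin
  f 0 +ᴿ Σ≤ n (λ k → f (suc k))
    ≡⟨ cong (f 0 +ᴿ_) (Σ-reverse n (λ k → f (suc k))) ⟩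
  f 0 +ᴿ (Σ[ k ≤ n ] f (suc (n ∸ k)))
    ≡⟨ +-comm (f 0) _ ⟩
  (Σ[ k ≤ n ] f (suc (n ∸ k))) +ᴿ f 0
    ≡⟨ cong₂ _+ᴿ_ (Σ-cong-< (suc n) (λ k k≤n → cong f (sym (ℕ.+-∸-assoc 1 (ℕ.≤-pred k≤n)))))
                  (cong f (sym (ℕ.n∸n≡0 (suc n)))) ⟩
  (Σ[ k ≤ n ] f (suc n ∸ k)) +ᴿ f (suc n ∸ suc n)
    ≡⟨ sym (Σ-last (suc n) (λ k → f (suc n ∸ k))) ⟩
  Σ[ k ≤ suc n ] f (suc n ∸ k) ∎

Σ-zero : ∀ n (f : ℕ → ℤ[φ]) → (∀ k → k ℕ.< n → f k ≡ 0ᴿ) → Σ< n f ≡ 0ᴿ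
Σ-zero zero f f≡0 = refl
Σ-zero (suc n) f f≡0 =
  trans (cong₂ _+ᴿ_ (f≡0 0 (ℕ.s≤s ℕ.z≤n)) (Σ-zero n (λ k → f (suc k)) (λ k k<n → f≡0 (suc k) (ℕ.s≤s k<n))))
        (+-identityˡ 0ᴿ)

Cᴿ : ℕ → ℕ → ℤ[φ]
Cᴿ n k = ιn (n C k)

binomial-theorem : ∀ x y n → Σ[ k ≤ n ] Cᴿ n k *ᴿ (x ^ᴿ k *ᴿ y ^ᴿ (n ∸ k)) ≡ (x +ᴿ y) ^ᴿ n
binomial-theorem x y n =
  sym (trans (Binomial.theorem n x y) (Σ-cong (suc n) (λ k → ×≡ιn* (n C k) (x ^ᴿ k *ᴿ y ^ᴿ (n ∸ k)))))

pascal-Σ : ∀ m (h : ℕ → ℤ[φ]) →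
  Σ[ j ≤ suc m ] Cᴿ (suc m) j *ᴿ h j ≡ (Σ[ j ≤ m ] Cᴿ m j *ᴿ h j) +ᴿ (Σ[ j ≤ m ] Cᴿ m j *ᴿ h (suc j))
pascal-Σ m h = begin
  Cᴿ m 0 *ᴿ h 0 +ᴿ (Σ[ j ≤ m ] Cᴿ (suc m) (suc j) *ᴿ h (suc j))
    ≡⟨ cong (Cᴿ m 0 *ᴿ h 0 +ᴿ_) (trans (Σ-cong (suc m) pascal)
         (Σ-distrib-+ (suc m) (λ j → Cᴿ m j *ᴿ h (suc j)) (λ j → Cᴿ m (suc j) *ᴿ h (suc j)))) ⟩
  Cᴿ m 0 *ᴿ h 0 +ᴿ (B +ᴿ (Σ[ j ≤ m ] Cᴿ m (suc j) *ᴿ h (suc j)))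
    ≡⟨ cong (λ t → Cᴿ m 0 *ᴿ h 0 +ᴿ (B +ᴿ t)) top-vanishes ⟩
  Cᴿ m 0 *ᴿ h 0 +ᴿ (B +ᴿ (Σ[ j < m ] Cᴿ m (suc j) *ᴿ h (suc j)))
    ≡⟨ +-rotate (Cᴿ m 0 *ᴿ h 0) B _ ⟩
  (Cᴿ m 0 *ᴿ h 0 +ᴿ (Σ[ j < m ] Cᴿ m (suc j) *ᴿ h (suc j))) +ᴿ B ∎
  where
  B = Σ[ j ≤ m ] Cᴿ m j *ᴿ h (suc j)
  pascal : ∀ j → Cᴿ (suc m) (suc j) *ᴿ h (suc j) ≡ Cᴿ m j *ᴿ h (suc j) +ᴿ Cᴿ m (suc j) *ᴿ h (suc j)
  pascal j = trans (cong (λ c → ιn c *ᴿ h (suc j)) (sym (nCk+nC[k+1]≡[n+1]C[k+1] m j)))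
                   (distribʳ (h (suc j)) (Cᴿ m j) (Cᴿ m (suc j)))
  +-rotate : ∀ a b c → a +ᴿ (b +ᴿ c) ≡ (a +ᴿ c) +ᴿ b
  +-rotate a b c = solve (a ∷ b ∷ c ∷ []) ℤ[φ]-ring
  zero-summand : ∀ a x → a +ᴿ 0ᴿ *ᴿ x ≡ a
  zero-summand a x = solve (a ∷ x ∷ []) ℤ[φ]-ring
  top-vanishes : Σ[ j ≤ m ] Cᴿ m (suc j) *ᴿ h (suc j) ≡ Σ[ j < m ] Cᴿ m (suc j) *ᴿ h (suc j)
  top-vanishes = begin
    Σ≤ m top
      ≡⟨ Σ-last m top ⟩
    Σ< m top +ᴿ ιn (m C suc m) *ᴿ h (suc m)
      ≡⟨ cong (λ c → Σ< m top +ᴿ ιn c *ᴿ h (suc m)) (k>n⇒nCk≡0 (ℕ.n<1+n m)) ⟩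
    Σ< m top +ᴿ 0ᴿ *ᴿ h (suc m)
      ≡⟨ zero-summand (Σ< m top) (h (suc m)) ⟩
    Σ< m top ∎
    where
    top : ℕ → ℤ[φ]
    top j = Cᴿ m (suc j) *ᴿ h (suc j)

-- Binomial convolution of sequences: the product of their exponential generating functions.
_⊛_ : (ℕ → ℤ[φ]) → (ℕ → ℤ[φ]) → ℕ → ℤ[φ]
(g ⊛ h) n = Σ[ k ≤ n ] Cᴿ n k *ᴿ g k *ᴿ h (n ∸ k)

-- Powers for ⊛; the unit is the sequence δₙ₀ = 0ⁿ.
_^⊛_ : (ℕ → ℤ[φ]) → ℕ → ℕ → ℤ[φ]
(g ^⊛ zero) n = 0ᴿ ^ᴿ n
(g ^⊛ suc r) n = (g ⊛ (g ^⊛ r)) n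

^⊛-cong : ∀ {g g′ : ℕ → ℤ[φ]} → (∀ k → g k ≡ g′ k) → ∀ r n → (g ^⊛ r) n ≡ (g′ ^⊛ r) n
^⊛-cong g≗g′ zero n = refl
^⊛-cong g≗g′ (suc r) n =
  Σ-cong (suc n) (λ k → cong₂ (λ x y → Cᴿ n k *ᴿ x *ᴿ y) (g≗g′ k) (^⊛-cong g≗g′ r (n ∸ k)))

^⊛-scale : ∀ w (g g′ : ℕ → ℤ[φ]) → (∀ k → g′ k ≡ w *ᴿ g k) →
  ∀ r n → w ^ᴿ r *ᴿ (g ^⊛ r) n ≡ (g′ ^⊛ r) n
^⊛-scale w g g′ g′≡wg zero n = *-identityˡ _
^⊛-scale w g g′ g′≡wg (suc r) n = begin
  w ^ᴿ suc r *ᴿ (Σ[ k ≤ n ] Cᴿ n k *ᴿ g k *ᴿ (g ^⊛ r) (n ∸ k))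
    ≡⟨ Σ-distribˡ-* (suc n) (w ^ᴿ suc r) (λ k → Cᴿ n k *ᴿ g k *ᴿ (g ^⊛ r) (n ∸ k)) ⟩
  Σ[ k ≤ n ] w ^ᴿ suc r *ᴿ (Cᴿ n k *ᴿ g k *ᴿ (g ^⊛ r) (n ∸ k))
    ≡⟨ Σ-cong (suc n) (λ k → trans (regroup w (w ^ᴿ r) (Cᴿ n k) (g k) ((g ^⊛ r) (n ∸ k)))
         (cong₂ (λ x y → Cᴿ n k *ᴿ x *ᴿ y) (sym (g′≡wg k)) (^⊛-scale w g g′ g′≡wg r (n ∸ k)))) ⟩
  Σ[ k ≤ n ] Cᴿ n k *ᴿ g′ k *ᴿ (g′ ^⊛ r) (n ∸ k) ∎
  where
  regroup : ∀ w wʳ c x y → (w *ᴿ wʳ) *ᴿ (c *ᴿ x *ᴿ y) ≡ c *ᴿ (w *ᴿ x) *ᴿ (wʳ *ᴿ y)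
  regroup w wʳ c x y = solve (w ∷ wʳ ∷ c ∷ x ∷ y ∷ []) ℤ[φ]-ring

⊛-Σ : ∀ (g : ℕ → ℤ[φ]) N (f : ℕ → ℕ → ℤ[φ]) n →
  (g ⊛ (λ m → Σ[ j < N ] f j m)) n ≡ Σ[ j < N ] (g ⊛ f j) n
⊛-Σ g N f n = begin
  Σ[ k ≤ n ] Cᴿ n k *ᴿ g k *ᴿ (Σ[ j < N ] f j (n ∸ k))
    ≡⟨ Σ-cong (suc n) (λ k → Σ-distribˡ-* N (Cᴿ n k *ᴿ g k) (λ j → f j (n ∸ k))) ⟩
  Σ[ k ≤ n ] Σ[ j < N ] Cᴿ n k *ᴿ g k *ᴿ f j (n ∸ k)
    ≡⟨ Σ-comm (suc n) N (λ k j → Cᴿ n k *ᴿ g k *ᴿ f j (n ∸ k)) ⟩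
  Σ[ j < N ] (g ⊛ f j) n ∎

⊛-scaleʳ : ∀ (g : ℕ → ℤ[φ]) t (f : ℕ → ℤ[φ]) n → (g ⊛ (λ m → t *ᴿ f m)) n ≡ t *ᴿ (g ⊛ f) n
⊛-scaleʳ g t f n = begin
  Σ[ k ≤ n ] Cᴿ n k *ᴿ g k *ᴿ (t *ᴿ f (n ∸ k))
    ≡⟨ Σ-cong (suc n) (λ k → swap-scalar (Cᴿ n k *ᴿ g k) t (f (n ∸ k))) ⟩
  Σ[ k ≤ n ] t *ᴿ (Cᴿ n k *ᴿ g k *ᴿ f (n ∸ k))
    ≡⟨ sym (Σ-distribˡ-* (suc n) t (λ k → Cᴿ n k *ᴿ g k *ᴿ f (n ∸ k))) ⟩
  t *ᴿ (g ⊛ f) n ∎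
  where
  swap-scalar : ∀ x t y → x *ᴿ (t *ᴿ y) ≡ t *ᴿ (x *ᴿ y)
  swap-scalar x t y = solve (x ∷ t ∷ y ∷ []) ℤ[φ]-ring

-- The sequence k ↦ aᵏ + s·bᵏ, with exponential generating function e^{ax} + s·e^{bx}.
twoExp : ℤ[φ] → ℤ[φ] → ℤ[φ] → ℕ → ℤ[φ]
twoExp a b s k = a ^ᴿ k +ᴿ s *ᴿ b ^ᴿ k

twoExp-⊛-exp : ∀ a b s z n → (twoExp a b s ⊛ (z ^ᴿ_)) n ≡ (a +ᴿ z) ^ᴿ n +ᴿ s *ᴿ (b +ᴿ z) ^ᴿ n
twoExp-⊛-exp a b s z n = begin
  Σ[ k ≤ n ] Cᴿ n k *ᴿ twoExp a b s k *ᴿ z ^ᴿ (n ∸ k)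
    ≡⟨ Σ-cong (suc n) (λ k → split-term (Cᴿ n k) (a ^ᴿ k) (b ^ᴿ k) (z ^ᴿ (n ∸ k))) ⟩
  Σ[ k ≤ n ] binomial-term a k +ᴿ s *ᴿ binomial-term b k
    ≡⟨ Σ-distrib-+ (suc n) (binomial-term a) (λ k → s *ᴿ binomial-term b k) ⟩
  Σ≤ n (binomial-term a) +ᴿ (Σ[ k ≤ n ] s *ᴿ binomial-term b k)
    ≡⟨ cong (Σ≤ n (binomial-term a) +ᴿ_) (sym (Σ-distribˡ-* (suc n) s (binomial-term b))) ⟩
  Σ≤ n (binomial-term a) +ᴿ s *ᴿ Σ≤ n (binomial-term b)
    ≡⟨ cong₂ (λ x y → x +ᴿ s *ᴿ y) (binomial-theorem a z n) (binomial-theorem b z n) ⟩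
  (a +ᴿ z) ^ᴿ n +ᴿ s *ᴿ (b +ᴿ z) ^ᴿ n ∎
  where
  binomial-term : ℤ[φ] → ℕ → ℤ[φ]
  binomial-term x k = Cᴿ n k *ᴿ (x ^ᴿ k *ᴿ z ^ᴿ (n ∸ k))
  split-term : ∀ c x y w → c *ᴿ (x +ᴿ s *ᴿ y) *ᴿ w ≡ c *ᴿ (x *ᴿ w) +ᴿ s *ᴿ (c *ᴿ (y *ᴿ w))
  split-term c x y w = solve (c ∷ x ∷ y ∷ w ∷ s ∷ []) ℤ[φ]-ring

-- The rate j·b + (r−j)·a of the j-th exponential in (e^{ax} + s·e^{bx})ʳ.
rate : ℤ[φ] → ℤ[φ] → ℕ → ℕ → ℤ[φ]
rate a b r j = ιn j *ᴿ b +ᴿ ιn (r ∸ j) *ᴿ a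

-- Raising the power r by one adds a to the rate of the j-th exponential (from the factor e^{ax})
-- or adds b and moves it to index j + 1 (from the factor s·e^{bx}).
rate-sucˡ : ∀ a b r j → j ℕ.≤ r → a +ᴿ rate a b r j ≡ rate a b (suc r) j
rate-sucˡ a b r j j≤r = begin
  a +ᴿ (ιn j *ᴿ b +ᴿ ιn (r ∸ j) *ᴿ a)      ≡⟨ shift (ιn j) (ιn (r ∸ j)) ⟩
  ιn j *ᴿ b +ᴿ (1ᴿ +ᴿ ιn (r ∸ j)) *ᴿ a     ≡⟨ cong (λ m → ιn j *ᴿ b +ᴿ ιn m *ᴿ a) (sym (ℕ.+-∸-assoc 1 j≤r)) ⟩
  ιn j *ᴿ b +ᴿ ιn (suc r ∸ j) *ᴿ a         ∎
  where
  shift : ∀ x y → a +ᴿ (x *ᴿ b +ᴿ y *ᴿ a) ≡ x *ᴿ b +ᴿ (1ᴿ +ᴿ y) *ᴿ a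
  shift x y = solve (a ∷ b ∷ x ∷ y ∷ []) ℤ[φ]-ring

rate-sucʳ : ∀ a b r j → b +ᴿ rate a b r j ≡ rate a b (suc r) (suc j)
rate-sucʳ a b r j = shift (ιn j) (ιn (r ∸ j))
  where
  shift : ∀ x y → b +ᴿ (x *ᴿ b +ᴿ y *ᴿ a) ≡ (1ᴿ +ᴿ x) *ᴿ b +ᴿ y *ᴿ a
  shift x y = solve (a ∷ b ∷ x ∷ y ∷ []) ℤ[φ]-ring

-- The n-th coefficient of C(r,j) sʲ e^{(jb + (r−j)a)x}, up to the factor 1/n!.
expTerm : (a b s : ℤ[φ]) (r n j : ℕ) → ℤ[φ]
expTerm a b s r n j = Cᴿ r j *ᴿ (s ^ᴿ j *ᴿ rate a b r j ^ᴿ n)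

twoExp-power : ∀ a b s r n → (twoExp a b s ^⊛ r) n ≡ Σ≤ r (expTerm a b s r n)
twoExp-power a b s zero n = sym (trans (unit-sum (rate a b 0 0 ^ᴿ n)) (cong (_^ᴿ n) (zero-rate a b)))
  where
  unit-sum : ∀ x → 1ᴿ *ᴿ (1ᴿ *ᴿ x) +ᴿ 0ᴿ ≡ x
  unit-sum x = solve (x ∷ []) ℤ[φ]-ring
  zero-rate : ∀ a b → 0ᴿ *ᴿ b +ᴿ 0ᴿ *ᴿ a ≡ 0ᴿ
  zero-rate a b = solve (a ∷ b ∷ []) ℤ[φ]-ring
twoExp-power a b s (suc r) n = begin
  (g ⊛ (g ^⊛ r)) n
    ≡⟨ Σ-cong (suc n) (λ k → cong (Cᴿ n k *ᴿ g k *ᴿ_) (twoExp-power a b s r (n ∸ k))) ⟩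
  (g ⊛ (λ m → Σ[ j ≤ r ] Cᴿ r j *ᴿ (s ^ᴿ j *ᴿ rate a b r j ^ᴿ m))) n
    ≡⟨ ⊛-Σ g (suc r) (λ j m → Cᴿ r j *ᴿ (s ^ᴿ j *ᴿ rate a b r j ^ᴿ m)) n ⟩
  Σ[ j ≤ r ] (g ⊛ (λ m → Cᴿ r j *ᴿ (s ^ᴿ j *ᴿ rate a b r j ^ᴿ m))) n
    ≡⟨ Σ-cong-< (suc r) (λ j j≤r → begin
         (g ⊛ (λ m → Cᴿ r j *ᴿ (s ^ᴿ j *ᴿ rate a b r j ^ᴿ m))) n
           ≡⟨ trans (⊛-scaleʳ g (Cᴿ r j) (λ m → s ^ᴿ j *ᴿ rate a b r j ^ᴿ m) n)
                    (cong (Cᴿ r j *ᴿ_) (⊛-scaleʳ g (s ^ᴿ j) (rate a b r j ^ᴿ_) n)) ⟩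
         Cᴿ r j *ᴿ (s ^ᴿ j *ᴿ (g ⊛ (rate a b r j ^ᴿ_)) n)
           ≡⟨ cong (λ x → Cᴿ r j *ᴿ (s ^ᴿ j *ᴿ x)) (twoExp-⊛-exp a b s (rate a b r j) n) ⟩
         Cᴿ r j *ᴿ (s ^ᴿ j *ᴿ ((a +ᴿ rate a b r j) ^ᴿ n +ᴿ s *ᴿ (b +ᴿ rate a b r j) ^ᴿ n))
           ≡⟨ cong₂ (λ x y → Cᴿ r j *ᴿ (s ^ᴿ j *ᴿ (x ^ᴿ n +ᴿ s *ᴿ y ^ᴿ n)))
                (rate-sucˡ a b r j (ℕ.≤-pred j≤r)) (rate-sucʳ a b r j) ⟩
         Cᴿ r j *ᴿ (s ^ᴿ j *ᴿ (h′ j +ᴿ s *ᴿ h′ (suc j)))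
           ≡⟨ distribute (Cᴿ r j) (s ^ᴿ j) (h′ j) (h′ (suc j)) ⟩
         Cᴿ r j *ᴿ h j +ᴿ Cᴿ r j *ᴿ h (suc j) ∎) ⟩
  Σ[ j ≤ r ] Cᴿ r j *ᴿ h j +ᴿ Cᴿ r j *ᴿ h (suc j)
    ≡⟨ Σ-distrib-+ (suc r) (λ j → Cᴿ r j *ᴿ h j) (λ j → Cᴿ r j *ᴿ h (suc j)) ⟩
  (Σ[ j ≤ r ] Cᴿ r j *ᴿ h j) +ᴿ (Σ[ j ≤ r ] Cᴿ r j *ᴿ h (suc j))
    ≡⟨ sym (pascal-Σ r h) ⟩
  Σ[ j ≤ suc r ] Cᴿ (suc r) j *ᴿ h j ∎
  where
  g = twoExp a b s
  h′ h : ℕ → ℤ[φ]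
  h′ j = rate a b (suc r) j ^ᴿ n
  h j = s ^ᴿ j *ᴿ h′ j
  distribute : ∀ c sʲ x y → c *ᴿ (sʲ *ᴿ (x +ᴿ s *ᴿ y)) ≡ c *ᴿ (sʲ *ᴿ x) +ᴿ c *ᴿ ((s *ᴿ sʲ) *ᴿ y)
  distribute c sʲ x y = solve (c ∷ sʲ ∷ x ∷ y ∷ s ∷ []) ℤ[φ]-ring

Σ-fold-odd : ∀ J (f : ℕ → ℤ[φ]) → Σ≤ (suc (J ℕ.+ J)) f ≡ Σ[ j ≤ J ] f j +ᴿ f (suc (J ℕ.+ J) ∸ j)
Σ-fold-odd J f = begin
  Σ< (suc (suc (J ℕ.+ J))) f
    ≡⟨ cong (λ m → Σ< (suc m) f) (sym (ℕ.+-suc J J)) ⟩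
  Σ< (suc J ℕ.+ suc J) f
    ≡⟨ Σ-split (suc J) (suc J) f ⟩
  Σ≤ J f +ᴿ (Σ[ i ≤ J ] f (suc J ℕ.+ i))
    ≡⟨ cong (Σ≤ J f +ᴿ_) (trans (Σ-reverse J (λ i → f (suc J ℕ.+ i)))
         (Σ-cong-< (suc J) (λ i i≤J → cong f (sym (ℕ.+-∸-assoc (suc J) (ℕ.≤-pred i≤J)))))) ⟩
  Σ≤ J f +ᴿ (Σ[ i ≤ J ] f (suc (J ℕ.+ J) ∸ i))
    ≡⟨ sym (Σ-distrib-+ (suc J) f (λ i → f (suc (J ℕ.+ J) ∸ i))) ⟩
  Σ[ j ≤ J ] f j +ᴿ f (suc (J ℕ.+ J) ∸ j) ∎

Σ-fold-even : ∀ J (f : ℕ → ℤ[φ]) →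
  Σ≤ (suc J ℕ.+ suc J) f ≡ (Σ[ j ≤ J ] f j +ᴿ f (suc J ℕ.+ suc J ∸ j)) +ᴿ f (suc J)
Σ-fold-even J f = begin
  Σ< (suc (suc J ℕ.+ suc J)) f
    ≡⟨ cong (λ m → Σ< m f) (sym (ℕ.+-suc (suc J) (suc J))) ⟩
  Σ< (suc J ℕ.+ suc (suc J)) f
    ≡⟨ Σ-split (suc J) (suc (suc J)) f ⟩
  Σ≤ J f +ᴿ (f (suc J ℕ.+ 0) +ᴿ (Σ[ i ≤ J ] f (suc J ℕ.+ suc i)))
    ≡⟨ cong₂ (λ x y → Σ≤ J f +ᴿ (f x +ᴿ y)) (ℕ.+-identityʳ (suc J))
         (trans (Σ-reverse J (λ i → f (suc J ℕ.+ suc i)))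
                (Σ-cong-< (suc J) (λ i i≤J → cong f (sym (mirror i (ℕ.≤-pred i≤J)))))) ⟩
  Σ≤ J f +ᴿ (f (suc J) +ᴿ (Σ[ i ≤ J ] f (r ∸ i)))
    ≡⟨ +-rotate (Σ≤ J f) (f (suc J)) _ ⟩
  (Σ≤ J f +ᴿ (Σ[ i ≤ J ] f (r ∸ i))) +ᴿ f (suc J)
    ≡⟨ cong (_+ᴿ f (suc J)) (sym (Σ-distrib-+ (suc J) f (λ i → f (r ∸ i)))) ⟩
  (Σ[ j ≤ J ] f j +ᴿ f (r ∸ j)) +ᴿ f (suc J) ∎
  where
  r = suc J ℕ.+ suc J
  mirror : ∀ i → i ℕ.≤ J → r ∸ i ≡ suc J ℕ.+ suc (J ∸ i)
  mirror i i≤J = trans (ℕ.+-∸-assoc (suc J) (ℕ.m≤n⇒m≤1+n i≤J)) (cong (suc J ℕ.+_) (ℕ.+-∸-assoc 1 i≤J))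
  +-rotate : ∀ x y z → x +ᴿ (y +ᴿ z) ≡ (x +ᴿ z) +ᴿ y
  +-rotate x y z = solve (x ∷ y ∷ z ∷ []) ℤ[φ]-ring

^-even : ∀ s j → s *ᴿ s ≡ 1ᴿ → s ^ᴿ (j ℕ.+ j) ≡ 1ᴿ
^-even s j s²≡1 = begin
  s ^ᴿ (j ℕ.+ j)     ≡⟨ ^-homo-* s j j ⟩
  s ^ᴿ j *ᴿ s ^ᴿ j   ≡⟨ sym (^-distrib-* s s j) ⟩
  (s *ᴿ s) ^ᴿ j      ≡⟨ cong (_^ᴿ j) s²≡1 ⟩
  1ᴿ ^ᴿ j            ≡⟨ 1^n≡1 j ⟩
  1ᴿ                 ∎

-- C(r,j) sʲ [e^{(ma + j)x} + sʳ e^{(mb + j)x}] with m = r − 2j: the combined terms j and r − j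
-- of the expansion of (e^{ax} + s·e^{bx})ʳ, see pair-terms.
pairedTerm : (a b s : ℤ[φ]) (r n j : ℕ) → ℤ[φ]
pairedTerm a b s r n j =
  Cᴿ r j *ᴿ s ^ᴿ j *ᴿ twoExp (ιn (r ∸ 2 ℕ.* j) *ᴿ a +ᴿ ιn j) (ιn (r ∸ 2 ℕ.* j) *ᴿ b +ᴿ ιn j) (s ^ᴿ r) n

mirror-index : ∀ r j → j ℕ.+ j ℕ.≤ r → r ∸ j ≡ j ℕ.+ (r ∸ 2 ℕ.* j)
mirror-index r j 2j≤r = sym (begin
  j ℕ.+ (r ∸ (j ℕ.+ (j ℕ.+ 0))) ≡⟨ cong (λ i → j ℕ.+ (r ∸ (j ℕ.+ i))) (ℕ.+-identityʳ j) ⟩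
  j ℕ.+ (r ∸ (j ℕ.+ j))         ≡⟨ cong (j ℕ.+_) (sym (ℕ.∸-+-assoc r j j)) ⟩
  j ℕ.+ (r ∸ j ∸ j)             ≡⟨ ℕ.m+[n∸m]≡n (ℕ.m+n≤o⇒m≤o∸n j 2j≤r) ⟩
  r ∸ j                         ∎)

-- If s² = 1 then s^{r−j} = sʲ·sʳ (both equal sʲ⁺ᵐ for r = 2j + m).
^-mirror : ∀ s r j → s *ᴿ s ≡ 1ᴿ → j ℕ.+ j ℕ.≤ r → s ^ᴿ (r ∸ j) ≡ s ^ᴿ j *ᴿ s ^ᴿ r
^-mirror s r j s²≡1 2j≤r = begin
  s ^ᴿ (r ∸ j)               ≡⟨ cong (s ^ᴿ_) (mirror-index r j 2j≤r) ⟩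
  s ^ᴿ (j ℕ.+ m)             ≡⟨ ^-homo-* s j m ⟩
  s ^ᴿ j *ᴿ s ^ᴿ m           ≡⟨ cong (s ^ᴿ j *ᴿ_) (sym sʳ≡sᵐ) ⟩
  s ^ᴿ j *ᴿ s ^ᴿ r           ∎
  where
  m = r ∸ 2 ℕ.* j
  sʳ≡sᵐ : s ^ᴿ r ≡ s ^ᴿ m
  sʳ≡sᵐ = begin
    s ^ᴿ r                     ≡⟨ cong (s ^ᴿ_) (trans (sym (ℕ.m+[n∸m]≡n (ℕ.m+n≤o⇒m≤o j 2j≤r)))
                                                      (cong (j ℕ.+_) (mirror-index r j 2j≤r))) ⟩
    s ^ᴿ (j ℕ.+ (j ℕ.+ m))     ≡⟨ cong (s ^ᴿ_) (sym (ℕ.+-assoc j j m)) ⟩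
    s ^ᴿ (j ℕ.+ j ℕ.+ m)       ≡⟨ ^-homo-* s (j ℕ.+ j) m ⟩
    s ^ᴿ (j ℕ.+ j) *ᴿ s ^ᴿ m   ≡⟨ cong (_*ᴿ s ^ᴿ m) (^-even s j s²≡1) ⟩
    1ᴿ *ᴿ s ^ᴿ m               ≡⟨ *-identityˡ (s ^ᴿ m) ⟩
    s ^ᴿ m                     ∎

rate-mirror : ∀ a b r j → a +ᴿ b ≡ 1ᴿ → j ℕ.+ j ℕ.≤ r →
  (rate a b r j ≡ ιn (r ∸ 2 ℕ.* j) *ᴿ a +ᴿ ιn j) × (rate a b r (r ∸ j) ≡ ιn (r ∸ 2 ℕ.* j) *ᴿ b +ᴿ ιn j)
rate-mirror a b r j a+b≡1 2j≤r = low , high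
  where
  M = ιn (r ∸ 2 ℕ.* j)
  regroup : ∀ J M x y → (J +ᴿ M) *ᴿ x +ᴿ J *ᴿ y ≡ M *ᴿ x +ᴿ J *ᴿ (x +ᴿ y)
  regroup J M x y = solve (J ∷ M ∷ x ∷ y ∷ []) ℤ[φ]-ring
  low : rate a b r j ≡ M *ᴿ a +ᴿ ιn j
  low = begin
    ιn j *ᴿ b +ᴿ ιn (r ∸ j) *ᴿ a   ≡⟨ cong (λ i → ιn j *ᴿ b +ᴿ ιn i *ᴿ a) (mirror-index r j 2j≤r) ⟩
    ιn j *ᴿ b +ᴿ (ιn j +ᴿ M) *ᴿ a  ≡⟨ trans (+-comm _ _) (regroup (ιn j) M a b) ⟩
    M *ᴿ a +ᴿ ιn j *ᴿ (a +ᴿ b)     ≡⟨ cong (λ x → M *ᴿ a +ᴿ ιn j *ᴿ x) a+b≡1 ⟩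
    M *ᴿ a +ᴿ ιn j *ᴿ 1ᴿ           ≡⟨ cong (M *ᴿ a +ᴿ_) (*-identityʳ (ιn j)) ⟩
    M *ᴿ a +ᴿ ιn j                 ∎
  high : rate a b r (r ∸ j) ≡ M *ᴿ b +ᴿ ιn j
  high = begin
    ιn (r ∸ j) *ᴿ b +ᴿ ιn (r ∸ (r ∸ j)) *ᴿ a
      ≡⟨ cong₂ (λ i i′ → ιn i *ᴿ b +ᴿ ιn i′ *ᴿ a) (mirror-index r j 2j≤r) (ℕ.m∸[m∸n]≡n (ℕ.m+n≤o⇒m≤o j 2j≤r)) ⟩
    (ιn j +ᴿ M) *ᴿ b +ᴿ ιn j *ᴿ a  ≡⟨ regroup (ιn j) M b a ⟩
    M *ᴿ b +ᴿ ιn j *ᴿ (b +ᴿ a)     ≡⟨ cong (λ x → M *ᴿ b +ᴿ ιn j *ᴿ x) (trans (+-comm b a) a+b≡1) ⟩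
    M *ᴿ b +ᴿ ιn j *ᴿ 1ᴿ           ≡⟨ cong (M *ᴿ b +ᴿ_) (*-identityʳ (ιn j)) ⟩
    M *ᴿ b +ᴿ ιn j                 ∎

pair-terms : ∀ a b s r n j → a +ᴿ b ≡ 1ᴿ → s *ᴿ s ≡ 1ᴿ → j ℕ.+ j ℕ.≤ r →
  expTerm a b s r n j +ᴿ expTerm a b s r n (r ∸ j) ≡ pairedTerm a b s r n j
pair-terms a b s r n j a+b≡1 s²≡1 2j≤r = begin
  Cᴿ r j *ᴿ (s ^ᴿ j *ᴿ rate a b r j ^ᴿ n) +ᴿ ιn (r C (r ∸ j)) *ᴿ (s ^ᴿ (r ∸ j) *ᴿ rate a b r (r ∸ j) ^ᴿ n)
    ≡⟨ cong₂ (λ c x → Cᴿ r j *ᴿ (s ^ᴿ j *ᴿ rate a b r j ^ᴿ n) +ᴿ ιn c *ᴿ (x *ᴿ rate a b r (r ∸ j) ^ᴿ n))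
         (sym (nCk≡nC[n∸k] (ℕ.m+n≤o⇒m≤o j 2j≤r))) (^-mirror s r j s²≡1 2j≤r) ⟩
  Cᴿ r j *ᴿ (s ^ᴿ j *ᴿ rate a b r j ^ᴿ n) +ᴿ Cᴿ r j *ᴿ ((s ^ᴿ j *ᴿ s ^ᴿ r) *ᴿ rate a b r (r ∸ j) ^ᴿ n)
    ≡⟨ cong₂ (λ x y → Cᴿ r j *ᴿ (s ^ᴿ j *ᴿ x ^ᴿ n) +ᴿ Cᴿ r j *ᴿ ((s ^ᴿ j *ᴿ s ^ᴿ r) *ᴿ y ^ᴿ n))
         (proj₁ rates) (proj₂ rates) ⟩
  Cᴿ r j *ᴿ (s ^ᴿ j *ᴿ x ^ᴿ n) +ᴿ Cᴿ r j *ᴿ ((s ^ᴿ j *ᴿ s ^ᴿ r) *ᴿ y ^ᴿ n)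
    ≡⟨ factor (Cᴿ r j) (s ^ᴿ j) (s ^ᴿ r) (x ^ᴿ n) (y ^ᴿ n) ⟩
  Cᴿ r j *ᴿ s ^ᴿ j *ᴿ twoExp x y (s ^ᴿ r) n ∎
  where
  rates = rate-mirror a b r j a+b≡1 2j≤r
  x = ιn (r ∸ 2 ℕ.* j) *ᴿ a +ᴿ ιn j
  y = ιn (r ∸ 2 ℕ.* j) *ᴿ b +ᴿ ιn j
  factor : ∀ c sʲ sʳ u v → c *ᴿ (sʲ *ᴿ u) +ᴿ c *ᴿ ((sʲ *ᴿ sʳ) *ᴿ v) ≡ c *ᴿ sʲ *ᴿ (u +ᴿ sʳ *ᴿ v)
  factor c sʲ sʳ u v = solve (c ∷ sʲ ∷ sʳ ∷ u ∷ v ∷ []) ℤ[φ]-ring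

power-odd : ∀ a b s J n → a +ᴿ b ≡ 1ᴿ → s *ᴿ s ≡ 1ᴿ →
  (twoExp a b s ^⊛ suc (J ℕ.+ J)) n ≡ Σ≤ J (pairedTerm a b s (suc (J ℕ.+ J)) n)
power-odd a b s J n a+b≡1 s²≡1 = begin
  (twoExp a b s ^⊛ r) n                                  ≡⟨ twoExp-power a b s r n ⟩
  Σ≤ r (expTerm a b s r n)                               ≡⟨ Σ-fold-odd J (expTerm a b s r n) ⟩
  Σ[ j ≤ J ] expTerm a b s r n j +ᴿ expTerm a b s r n (r ∸ j)
    ≡⟨ Σ-cong-< (suc J) (λ j j≤J →
         pair-terms a b s r n j a+b≡1 s²≡1 (ℕ.m≤n⇒m≤1+n (ℕ.+-mono-≤ (ℕ.≤-pred j≤J) (ℕ.≤-pred j≤J)))) ⟩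
  Σ≤ J (pairedTerm a b s r n)                            ∎
  where r = suc (J ℕ.+ J)

-- For even r = 2h the middle term j = h is unpaired; there the rate is h(a + b) = h.
power-even : ∀ a b s J n → a +ᴿ b ≡ 1ᴿ → s *ᴿ s ≡ 1ᴿ →
  (twoExp a b s ^⊛ (suc J ℕ.+ suc J)) n
    ≡ Σ≤ J (pairedTerm a b s (suc J ℕ.+ suc J) n)
      +ᴿ Cᴿ (suc J ℕ.+ suc J) (suc J) *ᴿ (s ^ᴿ suc J *ᴿ ιn (suc J) ^ᴿ n)
power-even a b s J n a+b≡1 s²≡1 = begin
  (twoExp a b s ^⊛ r) n                                  ≡⟨ twoExp-power a b s r n ⟩
  Σ≤ r (expTerm a b s r n)                               ≡⟨ Σ-fold-even J (expTerm a b s r n) ⟩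
  (Σ[ j ≤ J ] expTerm a b s r n j +ᴿ expTerm a b s r n (r ∸ j)) +ᴿ expTerm a b s r n h
    ≡⟨ cong₂ _+ᴿ_ (Σ-cong-< (suc J) (λ j j≤J →
                     pair-terms a b s r n j a+b≡1 s²≡1 (ℕ.+-mono-≤ (j≤h j≤J) (j≤h j≤J))))
                  (cong (λ x → Cᴿ r h *ᴿ (s ^ᴿ h *ᴿ x ^ᴿ n)) middle-rate) ⟩
  Σ≤ J (pairedTerm a b s r n) +ᴿ Cᴿ r h *ᴿ (s ^ᴿ h *ᴿ ιn h ^ᴿ n) ∎
  where
  h = suc J
  r = h ℕ.+ h
  j≤h : ∀ {j} → j ℕ.< suc J → j ℕ.≤ h
  j≤h j≤J = ℕ.m≤n⇒m≤1+n (ℕ.≤-pred j≤J)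
  middle-rate : rate a b r h ≡ ιn h
  middle-rate = begin
    ιn h *ᴿ b +ᴿ ιn (h ℕ.+ h ∸ h) *ᴿ a  ≡⟨ cong (λ m → ιn h *ᴿ b +ᴿ ιn m *ᴿ a) (ℕ.m+n∸m≡n h h) ⟩
    ιn h *ᴿ b +ᴿ ιn h *ᴿ a              ≡⟨ trans (+-comm _ _) (sym (distribˡ (ιn h) a b)) ⟩
    ιn h *ᴿ (a +ᴿ b)                    ≡⟨ trans (cong (ιn h *ᴿ_) a+b≡1) (*-identityʳ (ιn h)) ⟩
    ιn h                                ∎

ΣL : {A : Set} → (A → ℤ[φ]) → List A → ℤ[φ]
ΣL f [] = 0ᴿ
ΣL f (x ∷ xs) = f x +ᴿ ΣL f xs

ΣL-cong : ∀ {A : Set} {f g : A → ℤ[φ]} xs → (∀ x → f x ≡ g x) → ΣL f xs ≡ ΣL g xs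
ΣL-cong [] f≗g = refl
ΣL-cong (x ∷ xs) f≗g = cong₂ _+ᴿ_ (f≗g x) (ΣL-cong xs f≗g)

ι-sumℤ : ∀ {A : Set} (f : A → ℤ) xs → ι (sumℤ (List.map f xs)) ≡ ΣL (λ x → ι (f x)) xs
ι-sumℤ f [] = refl
ι-sumℤ f (x ∷ xs) = cong (ι (f x) +ᴿ_) (ι-sumℤ f xs)

ΣL-++ : ∀ {A : Set} (f : A → ℤ[φ]) xs ys → ΣL f (xs ++ ys) ≡ ΣL f xs +ᴿ ΣL f ys
ΣL-++ f [] ys = sym (+-identityˡ (ΣL f ys))
ΣL-++ f (x ∷ xs) ys = trans (cong (f x +ᴿ_) (ΣL-++ f xs ys)) (sym (+-assoc (f x) _ _))

ΣL-map : ∀ {A B : Set} (f : B → ℤ[φ]) (h : A → B) xs → ΣL f (List.map h xs) ≡ ΣL (λ x → f (h x)) xs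
ΣL-map f h [] = refl
ΣL-map f h (x ∷ xs) = cong (f (h x) +ᴿ_) (ΣL-map f h xs)

ΣL-concatMap : ∀ {A B : Set} (f : B → ℤ[φ]) (h : A → List B) xs →
  ΣL f (concatMap h xs) ≡ ΣL (λ x → ΣL f (h x)) xs
ΣL-concatMap f h [] = refl
ΣL-concatMap f h (x ∷ xs) =
  trans (ΣL-++ f (h x) (concatMap h xs)) (cong (ΣL f (h x) +ᴿ_) (ΣL-concatMap f h xs))

ΣL-applyUpTo : ∀ (f : ℕ → ℤ[φ]) (h : ℕ → ℕ) n → ΣL f (applyUpTo h n) ≡ Σ[ i < n ] f (h i)
ΣL-applyUpTo f h zero = refl
ΣL-applyUpTo f h (suc n) = cong (f (h 0) +ᴿ_) (ΣL-applyUpTo f (λ i → h (suc i)) n)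

ΣL-upTo : ∀ (f : ℕ → ℤ[φ]) n → ΣL f (upTo n) ≡ Σ< n f
ΣL-upTo f = ΣL-applyUpTo f (λ i → i)

ΣL-distribˡ-* : ∀ {A : Set} c (f : A → ℤ[φ]) xs → c *ᴿ ΣL f xs ≡ ΣL (λ x → c *ᴿ f x) xs
ΣL-distribˡ-* c f [] = zeroʳ c
ΣL-distribˡ-* c f (x ∷ xs) = trans (distribˡ c (f x) (ΣL f xs)) (cong (c *ᴿ f x +ᴿ_) (ΣL-distribˡ-* c f xs))

infixr 8 [_]·_
[_]·_ : {P : Set} → Dec P → ℤ[φ] → ℤ[φ]
[ yes _ ]· x = x
[ no _ ]· x = 0ᴿ

ΣL-filter : ∀ {A : Set} {P : A → Set} (P? : ∀ x → Dec (P x)) (f : A → ℤ[φ]) xs →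
  ΣL f (filter P? xs) ≡ ΣL (λ x → [ P? x ]· f x) xs
ΣL-filter P? f [] = refl
ΣL-filter P? f (x ∷ xs) with P? x
... | yes _ = cong (f x +ᴿ_) (ΣL-filter P? f xs)
... | no _ = trans (ΣL-filter P? f xs) (sym (+-identityˡ _))

[]·-ΣL : ∀ {A P : Set} (d : Dec P) (f : A → ℤ[φ]) xs → [ d ]· ΣL f xs ≡ ΣL (λ x → [ d ]· f x) xs
[]·-ΣL (yes _) f xs = refl
[]·-ΣL (no _) f [] = refl
[]·-ΣL (no ¬p) f (x ∷ xs) = trans (sym (+-identityˡ 0ᴿ)) (cong (0ᴿ +ᴿ_) ([]·-ΣL (no ¬p) f xs))

ι-sumTo : ∀ m (f : ℕ → ℤ) → ι (sumTo m f) ≡ Σ[ i ≤ m ] ι (f i)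
ι-sumTo m f = trans (ι-sumℤ f (upTo (suc m))) (ΣL-upTo (λ i → ι (f i)) (suc m))

innerSummand : (sg : ℕ → ℤ) (G : ℕ → ℕ) (r n k j : ℕ) → ℤ
innerSummand sg G r n k j = sg j * (+ (r C j)) * ((+ j) ^ (n ∸ k)) * ((+ (r ∸ 2 ℕ.* j)) ^ k) * (+ G k)

ι-innerSummand : ∀ s (sg : ℕ → ℤ) G r n k j → ι (sg j) ≡ s ^ᴿ j →
  ι (innerSummand sg G r n k j) ≡ s ^ᴿ j *ᴿ Cᴿ r j *ᴿ ιn j ^ᴿ (n ∸ k) *ᴿ ιn (r ∸ 2 ℕ.* j) ^ᴿ k *ᴿ ιn (G k)
ι-innerSummand s sg G r n k j sg≡sʲ = begin
  ι (c₃ * + G k)                               ≡⟨ ι-* c₃ (+ G k) ⟩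
  ι (c₂ * q) *ᴿ ιn (G k)                       ≡⟨ cong (_*ᴿ ιn (G k)) (ι-* c₂ q) ⟩
  ι (c₁ * p) *ᴿ ι q *ᴿ ιn (G k)                ≡⟨ cong (λ x → x *ᴿ ι q *ᴿ ιn (G k)) (ι-* c₁ p) ⟩
  ι (sg j * + (r C j)) *ᴿ ι p *ᴿ ι q *ᴿ ιn (G k)
    ≡⟨ cong₂ (λ x y → x *ᴿ y *ᴿ ι q *ᴿ ιn (G k))
         (trans (ι-* (sg j) (+ (r C j))) (cong (_*ᴿ Cᴿ r j) sg≡sʲ)) (ι-^ (+ j) (n ∸ k)) ⟩
  s ^ᴿ j *ᴿ Cᴿ r j *ᴿ ιn j ^ᴿ (n ∸ k) *ᴿ ι q *ᴿ ιn (G k)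
    ≡⟨ cong (λ x → s ^ᴿ j *ᴿ Cᴿ r j *ᴿ ιn j ^ᴿ (n ∸ k) *ᴿ x *ᴿ ιn (G k)) (ι-^ (+ (r ∸ 2 ℕ.* j)) k) ⟩
  s ^ᴿ j *ᴿ Cᴿ r j *ᴿ ιn j ^ᴿ (n ∸ k) *ᴿ ιn (r ∸ 2 ℕ.* j) ^ᴿ k *ᴿ ιn (G k) ∎
  where
  p = (+ j) ^ (n ∸ k)
  q = (+ (r ∸ 2 ℕ.* j)) ^ k
  c₁ = sg j * + (r C j)
  c₂ = c₁ * p
  c₃ = c₂ * q

-- A pair, expanded by the binomial theorem: C(r,j) sʲ Σₖ C(n,k) jⁿ⁻ᵏ mᵏ (aᵏ + sʳbᵏ), and
-- aᵏ + sʳbᵏ = w·G_k turns the k-th term into w·C(n,k)·(summand (k, j) of innerSum).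
pairedTerm-expand : ∀ a b s w (G : ℕ → ℕ) (sg : ℕ → ℤ) r n j →
  (∀ k → twoExp a b (s ^ᴿ r) k ≡ w *ᴿ ιn (G k)) → ι (sg j) ≡ s ^ᴿ j →
  pairedTerm a b s r n j ≡ Σ[ k ≤ n ] w *ᴿ (Cᴿ n k *ᴿ ι (innerSummand sg G r n k j))
pairedTerm-expand a b s w G sg r n j twoExp≡wG sg≡sʲ = begin
  Cᴿ r j *ᴿ s ^ᴿ j *ᴿ twoExp (M *ᴿ a +ᴿ ιn j) (M *ᴿ b +ᴿ ιn j) (s ^ᴿ r) n
    ≡⟨ cong (Cᴿ r j *ᴿ s ^ᴿ j *ᴿ_) (sym (twoExp-⊛-exp (M *ᴿ a) (M *ᴿ b) (s ^ᴿ r) (ιn j) n)) ⟩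
  Cᴿ r j *ᴿ s ^ᴿ j *ᴿ (twoExp (M *ᴿ a) (M *ᴿ b) (s ^ᴿ r) ⊛ (ιn j ^ᴿ_)) n
    ≡⟨ Σ-distribˡ-* (suc n) (Cᴿ r j *ᴿ s ^ᴿ j)
         (λ k → Cᴿ n k *ᴿ twoExp (M *ᴿ a) (M *ᴿ b) (s ^ᴿ r) k *ᴿ ιn j ^ᴿ (n ∸ k)) ⟩
  Σ[ k ≤ n ] Cᴿ r j *ᴿ s ^ᴿ j *ᴿ (Cᴿ n k *ᴿ ((M *ᴿ a) ^ᴿ k +ᴿ s ^ᴿ r *ᴿ (M *ᴿ b) ^ᴿ k) *ᴿ ιn j ^ᴿ (n ∸ k))
    ≡⟨ Σ-cong (suc n) (λ k → begin
         Cᴿ r j *ᴿ s ^ᴿ j *ᴿ (Cᴿ n k *ᴿ ((M *ᴿ a) ^ᴿ k +ᴿ s ^ᴿ r *ᴿ (M *ᴿ b) ^ᴿ k) *ᴿ ιn j ^ᴿ (n ∸ k))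
           ≡⟨ cong₂ (λ x y → Cᴿ r j *ᴿ s ^ᴿ j *ᴿ (Cᴿ n k *ᴿ (x +ᴿ s ^ᴿ r *ᴿ y) *ᴿ ιn j ^ᴿ (n ∸ k)))
                (^-distrib-* M a k) (^-distrib-* M b k) ⟩
         Cᴿ r j *ᴿ s ^ᴿ j *ᴿ (Cᴿ n k *ᴿ (M ^ᴿ k *ᴿ a ^ᴿ k +ᴿ s ^ᴿ r *ᴿ (M ^ᴿ k *ᴿ b ^ᴿ k)) *ᴿ ιn j ^ᴿ (n ∸ k))
           ≡⟨ rearrange (Cᴿ r j) (s ^ᴿ j) (Cᴿ n k) (ιn j ^ᴿ (n ∸ k)) (M ^ᴿ k) (a ^ᴿ k) (b ^ᴿ k) (s ^ᴿ r)
                w (ιn (G k)) (twoExp≡wG k) ⟩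
         w *ᴿ (Cᴿ n k *ᴿ (s ^ᴿ j *ᴿ Cᴿ r j *ᴿ ιn j ^ᴿ (n ∸ k) *ᴿ M ^ᴿ k *ᴿ ιn (G k)))
           ≡⟨ cong (λ x → w *ᴿ (Cᴿ n k *ᴿ x)) (sym (ι-innerSummand s sg G r n k j sg≡sʲ)) ⟩
         w *ᴿ (Cᴿ n k *ᴿ ι (innerSummand sg G r n k j)) ∎) ⟩
  Σ[ k ≤ n ] w *ᴿ (Cᴿ n k *ᴿ ι (innerSummand sg G r n k j)) ∎
  where
  M = ιn (r ∸ 2 ℕ.* j)
  rearrange : ∀ c sʲ cₙ jⁿ⁻ᵏ mᵏ x y t w g → x +ᴿ t *ᴿ y ≡ w *ᴿ g →
    c *ᴿ sʲ *ᴿ (cₙ *ᴿ (mᵏ *ᴿ x +ᴿ t *ᴿ (mᵏ *ᴿ y)) *ᴿ jⁿ⁻ᵏ) ≡ w *ᴿ (cₙ *ᴿ (sʲ *ᴿ c *ᴿ jⁿ⁻ᵏ *ᴿ mᵏ *ᴿ g))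
  rearrange c sʲ cₙ jⁿ⁻ᵏ mᵏ x y t w g x+ty≡wg = begin
    c *ᴿ sʲ *ᴿ (cₙ *ᴿ (mᵏ *ᴿ x +ᴿ t *ᴿ (mᵏ *ᴿ y)) *ᴿ jⁿ⁻ᵏ)
      ≡⟨ solve (c ∷ sʲ ∷ cₙ ∷ jⁿ⁻ᵏ ∷ mᵏ ∷ x ∷ y ∷ t ∷ []) ℤ[φ]-ring ⟩
    c *ᴿ sʲ *ᴿ (cₙ *ᴿ (mᵏ *ᴿ (x +ᴿ t *ᴿ y)) *ᴿ jⁿ⁻ᵏ)
      ≡⟨ cong (λ z → c *ᴿ sʲ *ᴿ (cₙ *ᴿ (mᵏ *ᴿ z) *ᴿ jⁿ⁻ᵏ)) x+ty≡wg ⟩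
    c *ᴿ sʲ *ᴿ (cₙ *ᴿ (mᵏ *ᴿ (w *ᴿ g)) *ᴿ jⁿ⁻ᵏ)
      ≡⟨ solve (c ∷ sʲ ∷ cₙ ∷ jⁿ⁻ᵏ ∷ mᵏ ∷ w ∷ g ∷ []) ℤ[φ]-ring ⟩
    w *ᴿ (cₙ *ᴿ (sʲ *ᴿ c *ᴿ jⁿ⁻ᵏ *ᴿ mᵏ *ᴿ g)) ∎

pairedSum≡innerSum : ∀ a b s w (G : ℕ → ℕ) (sg : ℕ → ℤ) r n J →
  (∀ k → twoExp a b (s ^ᴿ r) k ≡ w *ᴿ ιn (G k)) → (∀ j → ι (sg j) ≡ s ^ᴿ j) →
  Σ≤ J (pairedTerm a b s r n) ≡ w *ᴿ ι (innerSum sg G r n J)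
pairedSum≡innerSum a b s w G sg r n J twoExp≡wG sg≡sʲ = begin
  Σ≤ J (pairedTerm a b s r n)
    ≡⟨ Σ-cong (suc J) (λ j → pairedTerm-expand a b s w G sg r n j twoExp≡wG (sg≡sʲ j)) ⟩
  Σ[ j ≤ J ] Σ[ k ≤ n ] w *ᴿ (Cᴿ n k *ᴿ ι (t k j))
    ≡⟨ Σ-comm (suc J) (suc n) (λ j k → w *ᴿ (Cᴿ n k *ᴿ ι (t k j))) ⟩
  Σ[ k ≤ n ] Σ[ j ≤ J ] w *ᴿ (Cᴿ n k *ᴿ ι (t k j))
    ≡⟨ Σ-cong (suc n) (λ k → trans (sym (Σ-distribˡ-* (suc J) w (λ j → Cᴿ n k *ᴿ ι (t k j))))
                                    (cong (w *ᴿ_) (sym (Σ-distribˡ-* (suc J) (Cᴿ n k) (λ j → ι (t k j)))))) ⟩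
  Σ[ k ≤ n ] w *ᴿ (Cᴿ n k *ᴿ (Σ[ j ≤ J ] ι (t k j)))
    ≡⟨ sym (Σ-distribˡ-* (suc n) w (λ k → Cᴿ n k *ᴿ (Σ[ j ≤ J ] ι (t k j)))) ⟩
  w *ᴿ (Σ[ k ≤ n ] Cᴿ n k *ᴿ (Σ[ j ≤ J ] ι (t k j)))
    ≡⟨ cong (w *ᴿ_) (Σ-cong (suc n) (λ k → sym (trans (ι-* (+ (n C k)) (sumTo J (t k)))
                                                          (cong (Cᴿ n k *ᴿ_) (ι-sumTo J (t k)))))) ⟩
  w *ᴿ (Σ[ k ≤ n ] ι (+ (n C k) * sumTo J (t k)))
    ≡⟨ cong (w *ᴿ_) (sym (ι-sumTo n (λ k → + (n C k) * sumTo J (t k)))) ⟩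
  w *ᴿ ι (innerSum sg G r n J) ∎
  where
  t = innerSummand sg G r n

-- k₁!⋯kᵣ! divides (k₁+⋯+kᵣ)!, so multinomial (Σ v) v is an exact quotient.
prodFact∣sum! : ∀ {r} (v : Vec ℕ r) → prodFact v ∣ (Vec.sum v) !
prodFact∣sum! Vec.[] = divides 1 refl
prodFact∣sum! (k Vec.∷ v) = ∣-trans (*-monoʳ-∣ (k !) (prodFact∣sum! v))
  (subst (λ m → k ! ℕ.* m ! ∣ (k ℕ.+ Vec.sum v) !) (ℕ.m+n∸m≡n k (Vec.sum v))
         (k![n∸k]!∣n! (ℕ.m≤m+n k (Vec.sum v))))

multinomial-spec : ∀ {r} (v : Vec ℕ r) → multinomial (Vec.sum v) v ℕ.* prodFact v ≡ (Vec.sum v) !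
multinomial-spec v = m/n*n≡m {{prodFact≢0 v}} (prodFact∣sum! v)

binomial-spec : ∀ n k → k ℕ.≤ n → (n C k) ℕ.* (k ! ℕ.* (n ∸ k) !) ≡ n !
binomial-spec n k k≤n = trans (cong (ℕ._* (k ! ℕ.* (n ∸ k) !)) (nCk≡n!/k![n-k]! k≤n))
  (m/n*n≡m {{ℕ.m*n≢0 (k !) ((n ∸ k) !) {{k ℕ.!≢0}} {{(n ∸ k) ℕ.!≢0}}}} (k![n∸k]!∣n! k≤n))

multinomial-cons : ∀ {r} n k (v : Vec ℕ r) → k ℕ.+ Vec.sum v ≡ n →
  multinomial n (k Vec.∷ v) ≡ (n C k) ℕ.* multinomial (n ∸ k) v
multinomial-cons n k v k+Σv≡n = begin
  (n ! / (k ! ℕ.* P)) {{prodFact≢0 (k Vec.∷ v)}}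
    ≡⟨ cong (λ m → (m / (k ! ℕ.* P)) {{prodFact≢0 (k Vec.∷ v)}}) n!≡ ⟩
  ((n C k) ℕ.* q ℕ.* (k ! ℕ.* P) / (k ! ℕ.* P)) {{prodFact≢0 (k Vec.∷ v)}}
    ≡⟨ m*n/n≡m ((n C k) ℕ.* q) (k ! ℕ.* P) {{prodFact≢0 (k Vec.∷ v)}} ⟩
  (n C k) ℕ.* q
    ≡⟨ cong (λ m → (n C k) ℕ.* multinomial m v) (sym n∸k≡Σv) ⟩
  (n C k) ℕ.* multinomial (n ∸ k) v ∎
  where
  P = prodFact v
  q = multinomial (Vec.sum v) v
  n∸k≡Σv : n ∸ k ≡ Vec.sum v
  n∸k≡Σv = trans (cong (_∸ k) (sym k+Σv≡n)) (ℕ.m+n∸m≡n k (Vec.sum v))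
  k≤n : k ℕ.≤ n
  k≤n = subst (k ℕ.≤_) k+Σv≡n (ℕ.m≤m+n k (Vec.sum v))
  regroup : ∀ c q f P → c ℕ.* (f ℕ.* (q ℕ.* P)) ≡ c ℕ.* q ℕ.* (f ℕ.* P)
  regroup = ℕ-Solver.solve-∀
  n!≡ : n ! ≡ (n C k) ℕ.* q ℕ.* (k ! ℕ.* P)
  n!≡ = begin
    n !                                  ≡⟨ sym (binomial-spec n k k≤n) ⟩
    (n C k) ℕ.* (k ! ℕ.* (n ∸ k) !)      ≡⟨ cong (λ m → (n C k) ℕ.* (k ! ℕ.* m !)) n∸k≡Σv ⟩
    (n C k) ℕ.* (k ! ℕ.* (Vec.sum v) !)  ≡⟨ cong (λ m → (n C k) ℕ.* (k ! ℕ.* m)) (sym (multinomial-spec v)) ⟩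
    (n C k) ℕ.* (k ! ℕ.* (q ℕ.* P))      ≡⟨ regroup (n C k) q (k !) P ⟩
    (n C k) ℕ.* q ℕ.* (k ! ℕ.* P)        ∎

-- multiSum G r n b is the n-th coefficient (times n!) of (Σ_{k ≥ b} G_k xᵏ/k!)ʳ, i.e. the
-- r-th ⊛-power of the sequence G with its terms below b deleted.
module MultinomialSum (G : ℕ → ℕ) (b : ℕ) where

  admissible? : ∀ {r} n (v : Vec ℕ r) → Dec ((Vec.sum v ≡ n) × All (b ℕ.≤_) v)
  admissible? n v = (Vec.sum v ≟ n) ×-dec all? (b ≤?_) v

  term : ∀ {r} → ℕ → Vec ℕ r → ℤ[φ]
  term n v = [ admissible? n v ]· ιn (multinomial n v ℕ.* prodG G v)

  bounded : ℕ → ℕ → ℕ → ℤ[φ]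
  bounded r N n = ΣL (term n) (allVecs r N)

  multiSum≡bounded : ∀ r n → ι (multiSum G r n b) ≡ bounded r (suc n) n
  multiSum≡bounded r n =
    trans (ι-sumℤ (λ v → + (multinomial n v ℕ.* prodG G v)) (tuples r n b))
          (ΣL-filter (admissible? n) (λ v → ιn (multinomial n v ℕ.* prodG G v)) (allVecs r (suc n)))

  truncated : ℕ → ℤ[φ]
  truncated k = [ b ≤? k ]· ιn (G k)

  term-cons : ∀ {r} n k (v : Vec ℕ r) →
    term n (k Vec.∷ v) ≡ [ b ≤? k ]· [ k ≤? n ]· (ιn ((n C k) ℕ.* G k) *ᴿ term (n ∸ k) v)
  term-cons n k v = factor (admissible? n (k Vec.∷ v)) (b ≤? k) (k ≤? n) (admissible? (n ∸ k) v)
    where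
    Σv = Vec.sum v
    factor : (d : Dec ((k ℕ.+ Σv ≡ n) × All (b ℕ.≤_) (k Vec.∷ v))) (d₁ : Dec (b ℕ.≤ k)) (d₂ : Dec (k ℕ.≤ n))
             (d₃ : Dec ((Σv ≡ n ∸ k) × All (b ℕ.≤_) v)) →
      [ d ]· ιn (multinomial n (k Vec.∷ v) ℕ.* (G k ℕ.* prodG G v))
        ≡ [ d₁ ]· [ d₂ ]· (ιn ((n C k) ℕ.* G k) *ᴿ [ d₃ ]· ιn (multinomial (n ∸ k) v ℕ.* prodG G v))
    factor (yes (k+Σv≡n , _)) (yes _) (yes _) (yes _) = begin
      ιn (multinomial n (k Vec.∷ v) ℕ.* (G k ℕ.* prodG G v))
        ≡⟨ cong (λ m → ιn (m ℕ.* (G k ℕ.* prodG G v))) (multinomial-cons n k v k+Σv≡n) ⟩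
      ιn ((n C k) ℕ.* multinomial (n ∸ k) v ℕ.* (G k ℕ.* prodG G v))
        ≡⟨ cong ιn (regroup (n C k) (multinomial (n ∸ k) v) (G k) (prodG G v)) ⟩
      ιn ((n C k) ℕ.* G k ℕ.* (multinomial (n ∸ k) v ℕ.* prodG G v))
        ≡⟨ ιn-* ((n C k) ℕ.* G k) (multinomial (n ∸ k) v ℕ.* prodG G v) ⟩
      ιn ((n C k) ℕ.* G k) *ᴿ ιn (multinomial (n ∸ k) v ℕ.* prodG G v) ∎
      where
      regroup : ∀ c q g p → c ℕ.* q ℕ.* (g ℕ.* p) ≡ c ℕ.* g ℕ.* (q ℕ.* p)
      regroup = ℕ-Solver.solve-∀
    factor (yes (_ , b≤k All.∷ _)) (no b≰k) _ _ = ⊥-elim (b≰k b≤k)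
    factor (yes (k+Σv≡n , _)) (yes _) (no k≰n) _ = ⊥-elim (k≰n (subst (k ℕ.≤_) k+Σv≡n (ℕ.m≤m+n k Σv)))
    factor (yes (k+Σv≡n , _ All.∷ bv)) (yes _) (yes _) (no ¬tail) =
      ⊥-elim (¬tail (trans (sym (ℕ.m+n∸m≡n k Σv)) (cong (_∸ k) k+Σv≡n) , bv))
    factor (no ¬cons) (yes b≤k) (yes k≤n) (yes (Σv≡n∸k , bv)) =
      ⊥-elim (¬cons (trans (cong (k ℕ.+_) Σv≡n∸k) (ℕ.m+[n∸m]≡n k≤n) , b≤k All.∷ bv))
    factor (no _) (yes _) (yes _) (no _) = sym (zeroʳ (ιn ((n C k) ℕ.* G k)))
    factor (no _) (yes _) (no _) _ = refl
    factor (no _) (no _) _ _ = refl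

  bounded-suc : ∀ r N n →
    bounded (suc r) N n ≡ Σ[ k < N ] [ b ≤? k ]· [ k ≤? n ]· (ιn ((n C k) ℕ.* G k) *ᴿ bounded r N (n ∸ k))
  bounded-suc r N n = begin
    ΣL (term n) (concatMap (λ k → List.map (k Vec.∷_) (allVecs r N)) (upTo N))
      ≡⟨ ΣL-concatMap (term n) (λ k → List.map (k Vec.∷_) (allVecs r N)) (upTo N) ⟩
    ΣL (λ k → ΣL (term n) (List.map (k Vec.∷_) (allVecs r N))) (upTo N)
      ≡⟨ ΣL-upTo (λ k → ΣL (term n) (List.map (k Vec.∷_) (allVecs r N))) N ⟩
    Σ[ k < N ] ΣL (term n) (List.map (k Vec.∷_) (allVecs r N))
      ≡⟨ Σ-cong N first-entry ⟩
    Σ[ k < N ] [ b ≤? k ]· [ k ≤? n ]· (c k *ᴿ bounded r N (n ∸ k)) ∎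
    where
    c : ℕ → ℤ[φ]
    c k = ιn ((n C k) ℕ.* G k)
    first-entry : ∀ k → ΣL (term n) (List.map (k Vec.∷_) (allVecs r N))
                        ≡ [ b ≤? k ]· [ k ≤? n ]· (c k *ᴿ bounded r N (n ∸ k))
    first-entry k = begin
      ΣL (term n) (List.map (k Vec.∷_) (allVecs r N))
        ≡⟨ ΣL-map (term n) (k Vec.∷_) (allVecs r N) ⟩
      ΣL (λ v → term n (k Vec.∷ v)) (allVecs r N)
        ≡⟨ ΣL-cong (allVecs r N) (term-cons n k) ⟩
      ΣL (λ v → [ b ≤? k ]· [ k ≤? n ]· (c k *ᴿ term (n ∸ k) v)) (allVecs r N)
        ≡⟨ sym ([]·-ΣL (b ≤? k) (λ v → [ k ≤? n ]· (c k *ᴿ term (n ∸ k) v)) (allVecs r N)) ⟩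
      [ b ≤? k ]· ΣL (λ v → [ k ≤? n ]· (c k *ᴿ term (n ∸ k) v)) (allVecs r N)
        ≡⟨ cong ([ b ≤? k ]·_) (sym ([]·-ΣL (k ≤? n) (λ v → c k *ᴿ term (n ∸ k) v) (allVecs r N))) ⟩
      [ b ≤? k ]· [ k ≤? n ]· ΣL (λ v → c k *ᴿ term (n ∸ k) v) (allVecs r N)
        ≡⟨ cong (λ x → [ b ≤? k ]· [ k ≤? n ]· x) (sym (ΣL-distribˡ-* (c k) (term (n ∸ k)) (allVecs r N))) ⟩
      [ b ≤? k ]· [ k ≤? n ]· (c k *ᴿ bounded r N (n ∸ k)) ∎

  -- As long as N > n, the bound N on the entries is irrelevant and bounded is the ⊛-power; the
  -- summands k > n of bounded-suc vanish and the others are those of the convolution.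
  bounded≡power : ∀ r N n → n ℕ.< N → bounded r N n ≡ (truncated ^⊛ r) n
  bounded≡power zero N zero _ = refl
  bounded≡power zero N (suc n) _ = trans (+-identityʳ 0ᴿ) (sym (zeroˡ (0ᴿ ^ᴿ n)))
  bounded≡power (suc r) N n n<N = begin
    bounded (suc r) N n
      ≡⟨ bounded-suc r N n ⟩
    Σ< N summand
      ≡⟨ cong (λ m → Σ< m summand) (sym (ℕ.m+[n∸m]≡n n<N)) ⟩
    Σ< (suc n ℕ.+ (N ∸ suc n)) summand
      ≡⟨ Σ-split (suc n) (N ∸ suc n) summand ⟩
    Σ≤ n summand +ᴿ (Σ[ i < N ∸ suc n ] summand (suc n ℕ.+ i))
      ≡⟨ cong₂ _+ᴿ_ (Σ-cong-< (suc n) (λ k k≤n → low (ℕ.≤-pred k≤n)))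
                    (Σ-zero (N ∸ suc n) (λ i → summand (suc n ℕ.+ i)) (λ i _ → high (ℕ.s≤s (ℕ.m≤m+n n i)))) ⟩
    (truncated ^⊛ suc r) n +ᴿ 0ᴿ
      ≡⟨ +-identityʳ _ ⟩
    (truncated ^⊛ suc r) n ∎
    where
    summand : ℕ → ℤ[φ]
    summand k = [ b ≤? k ]· [ k ≤? n ]· (ιn ((n C k) ℕ.* G k) *ᴿ bounded r N (n ∸ k))
    IH : ∀ k → bounded r N (n ∸ k) ≡ (truncated ^⊛ r) (n ∸ k)
    IH k = bounded≡power r N (n ∸ k) (ℕ.≤-<-trans (ℕ.m∸n≤m n k) n<N)
    low : ∀ {k} → k ℕ.≤ n → summand k ≡ Cᴿ n k *ᴿ truncated k *ᴿ (truncated ^⊛ r) (n ∸ k)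
    low {k} k≤n with b ≤? k | k ≤? n
    ... | yes _ | yes _ = cong₂ _*ᴿ_ (ιn-* (n C k) (G k)) (IH k)
    ... | yes _ | no k≰n = ⊥-elim (k≰n k≤n)
    ... | no _ | _ = sym (trans (cong (_*ᴿ (truncated ^⊛ r) (n ∸ k)) (zeroʳ (Cᴿ n k))) (zeroˡ _))
    high : ∀ {k} → n ℕ.< k → summand k ≡ 0ᴿ
    high {k} n<k with b ≤? k | k ≤? n
    ... | yes _ | yes k≤n = ⊥-elim (ℕ.<⇒≱ n<k k≤n)
    ... | yes _ | no _ = refl
    ... | no _ | _ = refl

  multiSum≡power : ∀ r n → ι (multiSum G r n b) ≡ (truncated ^⊛ r) n
  multiSum≡power r n = trans (multiSum≡bounded r n) (bounded≡power r (suc n) n ℕ.≤-refl)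

-- The golden ratio φ, its conjugate ψ = 1 − φ and √5 = φ − ψ.
φ ψ √5 -1ᴿ : ℤ[φ]
φ = ⟨ + 0 , + 1 ⟩
ψ = ⟨ + 1 , -[1+ 0 ] ⟩
√5 = ⟨ -[1+ 0 ] , + 2 ⟩
-1ᴿ = ι -[1+ 0 ]

twoExp-rec : ∀ a b s k → a *ᴿ a ≡ 1ᴿ +ᴿ a → b *ᴿ b ≡ 1ᴿ +ᴿ b →
  twoExp a b s (suc (suc k)) ≡ twoExp a b s (suc k) +ᴿ twoExp a b s k
twoExp-rec a b s k a²≡1+a b²≡1+b = begin
  a *ᴿ (a *ᴿ a ^ᴿ k) +ᴿ s *ᴿ (b *ᴿ (b *ᴿ b ^ᴿ k))
    ≡⟨ cong₂ (λ x y → x +ᴿ s *ᴿ y) (sym (*-assoc a a (a ^ᴿ k))) (sym (*-assoc b b (b ^ᴿ k))) ⟩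
  a *ᴿ a *ᴿ a ^ᴿ k +ᴿ s *ᴿ (b *ᴿ b *ᴿ b ^ᴿ k)
    ≡⟨ cong₂ (λ x y → x *ᴿ a ^ᴿ k +ᴿ s *ᴿ (y *ᴿ b ^ᴿ k)) a²≡1+a b²≡1+b ⟩
  (1ᴿ +ᴿ a) *ᴿ a ^ᴿ k +ᴿ s *ᴿ ((1ᴿ +ᴿ b) *ᴿ b ^ᴿ k)
    ≡⟨ regroup (a ^ᴿ k) (b ^ᴿ k) ⟩
  twoExp a b s (suc k) +ᴿ twoExp a b s k ∎
  where
  regroup : ∀ x y → (1ᴿ +ᴿ a) *ᴿ x +ᴿ s *ᴿ ((1ᴿ +ᴿ b) *ᴿ y) ≡ (a *ᴿ x +ᴿ s *ᴿ (b *ᴿ y)) +ᴿ (x +ᴿ s *ᴿ y)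
  regroup x y = solve (a ∷ b ∷ s ∷ x ∷ y ∷ []) ℤ[φ]-ring

binet-F : ∀ k → twoExp φ ψ -1ᴿ k ≡ √5 *ᴿ ιn (F k)
binet-F zero = refl
binet-F (suc zero) = refl
binet-F (suc (suc k)) = begin
  twoExp φ ψ -1ᴿ (suc (suc k))                  ≡⟨ twoExp-rec φ ψ -1ᴿ k refl refl ⟩
  twoExp φ ψ -1ᴿ (suc k) +ᴿ twoExp φ ψ -1ᴿ k    ≡⟨ cong₂ _+ᴿ_ (binet-F (suc k)) (binet-F k) ⟩
  √5 *ᴿ ιn (F (suc k)) +ᴿ √5 *ᴿ ιn (F k)        ≡⟨ sym (distribˡ √5 (ιn (F (suc k))) (ιn (F k))) ⟩
  √5 *ᴿ ιn (F (suc (suc k)))                    ∎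

binet-L : ∀ k → twoExp φ ψ 1ᴿ k ≡ ιn (L k)
binet-L zero = refl
binet-L (suc zero) = refl
binet-L (suc (suc k)) =
  trans (twoExp-rec φ ψ 1ᴿ k refl refl) (cong₂ _+ᴿ_ (binet-L (suc k)) (binet-L k))

multiSum-F : ∀ r n → √5 ^ᴿ r *ᴿ ι (multiSum F r n 1) ≡ (twoExp φ ψ -1ᴿ ^⊛ r) n
multiSum-F r n = trans (cong (√5 ^ᴿ r *ᴿ_) (MultinomialSum.multiSum≡power F 1 r n))
                       (^⊛-scale √5 (MultinomialSum.truncated F 1) (twoExp φ ψ -1ᴿ) binet-F′ r n)
  where
  binet-F′ : ∀ k → twoExp φ ψ -1ᴿ k ≡ √5 *ᴿ MultinomialSum.truncated F 1 k
  binet-F′ zero = refl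
  binet-F′ (suc k) = binet-F (suc k)

multiSum-L : ∀ r n → ι (multiSum L r n 0) ≡ (twoExp φ ψ 1ᴿ ^⊛ r) n
multiSum-L r n = trans (MultinomialSum.multiSum≡power L 0 r n) (^⊛-cong (λ k → sym (binet-L k)) r n)

-- ι is injective, and so is multiplication by √5 on its image (compare φ-coordinates: 2x = 2y).
ι-injective : ∀ {x y} → ι x ≡ ι y → x ≡ y
ι-injective refl = refl

√5-cancel : ∀ x y → √5 *ᴿ ι x ≡ √5 *ᴿ ι y → x ≡ y
√5-cancel x y √5x≡√5y =
  ℤ.*-cancelˡ-≡ (+ 2) x y (trans (sym (φ-coordinate x)) (trans (cong φ-part √5x≡√5y) (φ-coordinate y)))
  where
  φ-part : ℤ[φ] → ℤ
  φ-part ⟨ _ , b ⟩ = b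
  φ-coordinate : ∀ z → φ-part (√5 *ᴿ ι z) ≡ + 2 * z
  φ-coordinate z = expanded
    where
    expanded : -[1+ 0 ] * + 0 + + 2 * z + + 2 * + 0 ≡ + 2 * z
    expanded = ℤ-Solver.solve (z ∷ [])

ι-sgn : ∀ j → ι (sgn j) ≡ -1ᴿ ^ᴿ j
ι-sgn = ι-^ -[1+ 0 ]

ι-5^ : ∀ J → ι ((+ 5) ^ J) ≡ √5 ^ᴿ (J ℕ.+ J)
ι-5^ J = trans (ι-^ (+ 5) J) (trans (^-distrib-* √5 √5 J) (sym (^-homo-* √5 J J)))

odd-case : ∀ s w (G : ℕ → ℕ) (sg : ℕ → ℤ) J n → s *ᴿ s ≡ 1ᴿ →
  (∀ k → twoExp φ ψ s k ≡ w *ᴿ ιn (G k)) → (∀ j → ι (sg j) ≡ s ^ᴿ j) →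
  (twoExp φ ψ s ^⊛ suc (J ℕ.+ J)) n ≡ w *ᴿ ι (innerSum sg G (suc (J ℕ.+ J)) n J)
odd-case s w G sg J n s²≡1 twoExp≡wG sg≡sʲ =
  trans (power-odd φ ψ s J n refl s²≡1)
        (pairedSum≡innerSum φ ψ s w G sg (suc (J ℕ.+ J)) n J
           (λ k → trans (cong (λ t → twoExp φ ψ t k) sʳ≡s) (twoExp≡wG k)) sg≡sʲ)
  where
  sʳ≡s : s ^ᴿ suc (J ℕ.+ J) ≡ s
  sʳ≡s = trans (cong (s *ᴿ_) (^-even s J s²≡1)) (*-identityʳ s)

-- For even r = 2h the pairs produce Lucas numbers, and the middle term C(r,h) sʰ hⁿ is left over.
even-case : ∀ s (sg : ℕ → ℤ) J n → s *ᴿ s ≡ 1ᴿ → (∀ j → ι (sg j) ≡ s ^ᴿ j) →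
  (twoExp φ ψ s ^⊛ (suc J ℕ.+ suc J)) n
    ≡ ι (innerSum sg L (suc J ℕ.+ suc J) n J + sg (suc J) * + ((suc J ℕ.+ suc J) C suc J) * (+ suc J) ^ n)
even-case s sg J n s²≡1 sg≡sʲ = begin
  (twoExp φ ψ s ^⊛ r) n
    ≡⟨ power-even φ ψ s J n refl s²≡1 ⟩
  Σ≤ J (pairedTerm φ ψ s r n) +ᴿ Cᴿ r h *ᴿ (s ^ᴿ h *ᴿ ιn h ^ᴿ n)
    ≡⟨ cong₂ _+ᴿ_ (trans (pairedSum≡innerSum φ ψ s 1ᴿ L sg r n J twoExp≡L sg≡sʲ)
                         (*-identityˡ (ι (innerSum sg L r n J))))
                  (sym middle) ⟩
  ι (innerSum sg L r n J) +ᴿ ι (sg h * + (r C h) * (+ h) ^ n) ∎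
  where
  h = suc J
  r = h ℕ.+ h
  twoExp≡L : ∀ k → twoExp φ ψ (s ^ᴿ r) k ≡ 1ᴿ *ᴿ ιn (L k)
  twoExp≡L k =
    trans (cong (λ t → twoExp φ ψ t k) (^-even s h s²≡1)) (trans (binet-L k) (sym (*-identityˡ (ιn (L k)))))
  middle : ι (sg h * + (r C h) * (+ h) ^ n) ≡ Cᴿ r h *ᴿ (s ^ᴿ h *ᴿ ιn h ^ᴿ n)
  middle = begin
    ι (sg h * + (r C h) * (+ h) ^ n)
      ≡⟨ ι-* (sg h * + (r C h)) ((+ h) ^ n) ⟩
    ι (sg h * + (r C h)) *ᴿ ι ((+ h) ^ n)
      ≡⟨ cong₂ _*ᴿ_ (trans (ι-* (sg h) (+ (r C h))) (cong (_*ᴿ Cᴿ r h) (sg≡sʲ h))) (ι-^ (+ h) n) ⟩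
    s ^ᴿ h *ᴿ Cᴿ r h *ᴿ ιn h ^ᴿ n
      ≡⟨ regroup (s ^ᴿ h) (Cᴿ r h) (ιn h ^ᴿ n) ⟩
    Cᴿ r h *ᴿ (s ^ᴿ h *ᴿ ιn h ^ᴿ n) ∎
    where
    regroup : ∀ x c y → x *ᴿ c *ᴿ y ≡ c *ᴿ (x *ᴿ y)
    regroup x c y = solve (x ∷ c ∷ y ∷ []) ℤ[φ]-ring

fibonacci-odd : ∀ J n → (+ 5) ^ J * multiSum F (suc (J ℕ.+ J)) n 1 ≡ innerSum sgn F (suc (J ℕ.+ J)) n J
fibonacci-odd J n = √5-cancel _ _ (begin
  √5 *ᴿ ι ((+ 5) ^ J * X)          ≡⟨ cong (√5 *ᴿ_) (trans (ι-* ((+ 5) ^ J) X) (cong (_*ᴿ ι X) (ι-5^ J))) ⟩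
  √5 *ᴿ (√5 ^ᴿ (J ℕ.+ J) *ᴿ ι X)   ≡⟨ sym (*-assoc √5 (√5 ^ᴿ (J ℕ.+ J)) (ι X)) ⟩
  √5 ^ᴿ r *ᴿ ι X                   ≡⟨ multiSum-F r n ⟩
  (twoExp φ ψ -1ᴿ ^⊛ r) n          ≡⟨ odd-case -1ᴿ √5 F sgn J n refl binet-F ι-sgn ⟩
  √5 *ᴿ ι (innerSum sgn F r n J)   ∎)
  where
  r = suc (J ℕ.+ J)
  X = multiSum F r n 1

lucas-odd : ∀ J n → multiSum L (suc (J ℕ.+ J)) n 0 ≡ innerSum (λ _ → + 1) L (suc (J ℕ.+ J)) n J
lucas-odd J n = ι-injective (begin
  ι (multiSum L r n 0)                  ≡⟨ multiSum-L r n ⟩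
  (twoExp φ ψ 1ᴿ ^⊛ r) n
    ≡⟨ odd-case 1ᴿ 1ᴿ L (λ _ → + 1) J n refl
         (λ k → trans (binet-L k) (sym (*-identityˡ (ιn (L k))))) (λ j → sym (1^n≡1 j)) ⟩
  1ᴿ *ᴿ ι (innerSum (λ _ → + 1) L r n J) ≡⟨ *-identityˡ _ ⟩
  ι (innerSum (λ _ → + 1) L r n J)       ∎)
  where
  r = suc (J ℕ.+ J)

fibonacci-even : ∀ J n → let h = suc J; r = h ℕ.+ h in
  (+ 5) ^ h * multiSum F r n 1 ≡ innerSum sgn L r n J + sgn h * + (r C h) * (+ h) ^ n
fibonacci-even J n = ι-injective (begin
  ι ((+ 5) ^ h * X)                ≡⟨ trans (ι-* ((+ 5) ^ h) X) (cong (_*ᴿ ι X) (ι-5^ h)) ⟩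
  √5 ^ᴿ r *ᴿ ι X                   ≡⟨ multiSum-F r n ⟩
  (twoExp φ ψ -1ᴿ ^⊛ r) n          ≡⟨ even-case -1ᴿ sgn J n refl ι-sgn ⟩
  ι (innerSum sgn L r n J + sgn h * + (r C h) * (+ h) ^ n) ∎)
  where
  h = suc J
  r = h ℕ.+ h
  X = multiSum F r n 1

lucas-even : ∀ J n → let h = suc J; r = h ℕ.+ h in
  multiSum L r n 0 ≡ innerSum (λ _ → + 1) L r n J + + (r C h) * (+ h) ^ n
lucas-even J n = ι-injective (begin
  ι (multiSum L r n 0)         ≡⟨ multiSum-L r n ⟩
  (twoExp φ ψ 1ᴿ ^⊛ r) n       ≡⟨ even-case 1ᴿ (λ _ → + 1) J n refl (λ j → sym (1^n≡1 j)) ⟩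
  ι (innerSum (λ _ → + 1) L r n J + + 1 * + (r C h) * (+ h) ^ n)
    ≡⟨ cong (λ c → ι (innerSum (λ _ → + 1) L r n J + c * (+ h) ^ n)) (ℤ.*-identityˡ (+ (r C h))) ⟩
  ι (innerSum (λ _ → + 1) L r n J + + (r C h) * (+ h) ^ n) ∎)
  where
  h = suc J
  r = h ℕ.+ h

data Parity : ℕ → Set where
  even : ∀ J → Parity (J ℕ.+ J)
  odd  : ∀ J → Parity (suc (J ℕ.+ J))

parity : ∀ r → Parity r
parity zero = even 0
parity (suc r) with parity r
... | even J = odd J
... | odd J = subst Parity (cong suc (ℕ.+-suc J J)) (even (suc J))

J+J≡J*2 : ∀ J → J ℕ.+ J ≡ J ℕ.* 2
J+J≡J*2 J = trans (cong (J ℕ.+_) (sym (ℕ.+-identityʳ J))) (ℕ.*-comm 2 J)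

half : ∀ J → (J ℕ.+ J) / 2 ≡ J
half J = trans (cong (_/ 2) (J+J≡J*2 J)) (m*n/n≡m J 2)

even%2 : ∀ J → (J ℕ.+ J) % 2 ≡ 0
even%2 J = trans (cong (_% 2) (J+J≡J*2 J)) (m*n%n≡0 J 2)

odd%2 : ∀ J → suc (J ℕ.+ J) % 2 ≡ 1
odd%2 J = trans (cong (λ m → suc m % 2) (J+J≡J*2 J)) ([m+kn]%n≡m%n 1 J 2)

corollary5 : (r n : ℕ) → 1 ≤ r →
  (r % 2 ≡ 1 →
    ((+ 5) ^ ((r ∸ 1) / 2) * multiSum F r n 1 ≡ innerSum sgn F r n ((r ∸ 1) / 2))
    × (multiSum L r n 0 ≡ innerSum (λ _ → + 1) L r n ((r ∸ 1) / 2)))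
  × (r % 2 ≡ 0 →
    ((+ 5) ^ (r / 2) * multiSum F r n 1
        ≡ innerSum sgn L r n (r / 2 ∸ 1) + sgn (r / 2) * + (r C (r / 2)) * (+ (r / 2)) ^ n)
    × (multiSum L r n 0
        ≡ innerSum (λ _ → + 1) L r n (r / 2 ∸ 1) + + (r C (r / 2)) * (+ (r / 2)) ^ n))
corollary5 r n 1≤r with parity r
... | even zero = contradiction 1≤r λ ()
... | even (suc J) rewrite half (suc J) =
  (λ r%2≡1 → contradiction (trans (sym (even%2 (suc J))) r%2≡1) λ ()) ,
  (λ _ → fibonacci-even J n , lucas-even J n)
... | odd J rewrite half J =
  (λ _ → fibonacci-odd J n , lucas-odd J n) ,
  (λ r%2≡0 → contradiction (trans (sym (odd%2 J)) r%2≡0) λ ())
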